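{- Let $B$ be a brick and let $L$ be a list-assignment for $B$. Then: (a) If $B$ is a balanced complete graph or a balanced odd cycle with parts $X,Y$, then $(B,L)$ is an uncolorable pair if and only if there is a color set $C$ with $|C|=\Delta(B)$, $L(v)=C$ for all $v\in X$, and $L(v)=-C$ for all $v\in Y$. (b) If $B$ is an unbalanced even cycle, a $2K_n$ with $n\ge2$, or a $2C_n$ with $n\ge3$ odd, then $(B,L)$ is an uncolorable pair if and only if there is a symmetric color set $C$ (i.e. $C=-C$) with $|C|=\Delta(B)$ and $L(v)=C$ for all $v\in V(B)$.
   Context: A signed graph is a finite graph (multiple edges allowed, no loops) with a sign map $\sigma$ assigning $\pm1$ to each edge; degrees count edges with multiplicity. A coloring is a map $\phi:V\to\mathbb{Z}$ with $\phi(v)\ne\sigma(e)\phi(w)$ for every edge $e$ with ends $v,w$. A list-assignment $L$ assigns a set $L(v)\subseteq\mathbb{Z}$ to each vertex; an $L$-coloring is a coloring with $\phi(v)\in L(v)$. For $C\subseteq\mathbb{Z}$, $-C=\{ -c:c\in C\}$. An uncolorable pair is a pair $(G,L)$ with $G$ a connected signed graph, $|L(v)|\ge d_G(v)$ for all $v$, and $G$ not $L$-colorable. $G$ is balanced with parts $X,Y$ if $V(G)=X\cup Y$ disjointly (one may be empty) and an edge is negative iff it joins $X$ and $Y$; balanced means every cycle has positive sign product (product of edge signs). A brick is one of: a balanced complete graph (underlying graph a simple $K_n$, $n\ge1$); a balanced odd cycle; an unbalanced even cycle; $2K_n$ for $n\ge2$; $2C_n$ for odd $n\ge3$, where a cycle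 is a signed graph whose underlying graph is a cycle and $2H$ (for a simple graph $H$) is obtained by replacing each edge of $H$ by a positive and a negative parallel edge. -}

module Defs where

open import Data.Nat using (ℕ; zero; suc; _≤_; _*_; _⊔_; _≡ᵇ_)
open import Data.Bool using (Bool; true; false; _∧_; _∨_; if_then_else_)
open import Data.Fin using (Fin; toℕ)
open import Data.Fin.Properties using () renaming (_≟_ to _≟F_)
open import Data.Integer using (ℤ; -_)
open import Data.Sign using (Sign) renaming (_≟_ to _≟S_)
open import Data.List using (List; []; _∷_; length; filterᵇ; map; foldr; upTo; allFin)
open import Data.List.Membership.Propositional using (_∈_)
open import Data.List.Relation.Unary.All using (All)
open import Data.List.Relation.Unary.Unique.Propositional using (Unique)
open import Data.Product using (Σ; _×_; _,_; ∃; ∃-syntax)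
open import Relation.Nullary using (¬_; ⌊_⌋)
open import Relation.Binary.PropositionalEquality using (_≡_; _≢_)
open import Function.Definitions using (Injective)
open import Function.Bundles using (_⇔_)

-- Signed multigraphs on vertex set Fin n.
-- An edge is a triple (u , w , s): ends u, w and sign s ∈ {+,-}.
-- Parallel edges are allowed (the edge list may repeat ends); loops are not.

Edge : ℕ → Set
Edge n = Fin n × Fin n × Sign

record SGraph : Set where
  field
    n      : ℕ
    edges  : List (Edge n)
    noLoop : All (λ { (u , w , s) → u ≢ w }) edges
open SGraph public

act : Sign → ℤ → ℤ
act Sign.+ x = x
act Sign.- x = - x

hasEnd : ∀ {n} → Fin n → Edge n → Bool
hasEnd v (u , w , s) = ⌊ u ≟F v ⌋ ∨ ⌊ w ≟F v ⌋

joins : ∀ {n} → Fin n → Fin n → Edge n → Bool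
joins a b (u , w , s) = (⌊ u ≟F a ⌋ ∧ ⌊ w ≟F b ⌋) ∨ (⌊ u ≟F b ⌋ ∧ ⌊ w ≟F a ⌋)

signIs : ∀ {n} → Sign → Edge n → Bool
signIs t (u , w , s) = ⌊ s ≟S t ⌋

deg : (G : SGraph) → Fin (n G) → ℕ
deg G v = length (filterᵇ (hasEnd v) (edges G))

-- maximum degree Δ(G) (0 for the graph with no vertices)
Δ : SGraph → ℕ
Δ G = foldr _⊔_ 0 (map (deg G) (allFin (n G)))

mult : (G : SGraph) → Fin (n G) → Fin (n G) → ℕ
mult G a b = length (filterᵇ (joins a b) (edges G))

posMult : (G : SGraph) → Fin (n G) → Fin (n G) → ℕ
posMult G a b = length (filterᵇ (λ e → joins a b e ∧ signIs Sign.+ e) (edges G))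

negMult : (G : SGraph) → Fin (n G) → Fin (n G) → ℕ
negMult G a b = length (filterᵇ (λ e → joins a b e ∧ signIs Sign.- e) (edges G))

Adjacent : (G : SGraph) → Fin (n G) → Fin (n G) → Set
Adjacent G a b = ∃[ e ] (e ∈ edges G × joins a b e ≡ true)

data Reach (G : SGraph) (a : Fin (n G)) : Fin (n G) → Set where
  here : Reach G a a
  step : ∀ {b c} → Reach G a b → Adjacent G b c → Reach G a c

Connected : SGraph → Set
Connected G = ∀ a b → Reach G a b

-- Balance: G is balanced with parts X = {v | X v ≡ true}, Y = complement,
-- if an edge is negative iff it joins X and Y.

crosses : ∀ {n} → (Fin n → Bool) → Fin n → Fin n → Bool
crosses X u w = if X u then (if X w then false else true) else X w

BalancedWith : (G : SGraph) → (Fin (n G) → Bool) → Set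
BalancedWith G X =
  All (λ { (u , w , s) → (s ≡ Sign.- ⇔ crosses X u w ≡ true) }) (edges G)

Balanced : SGraph → Set
Balanced G = ∃[ X ] BalancedWith G X

Odd Even : ℕ → Set
Odd m = ∃[ k ] m ≡ suc (2 * k)
Even m = ∃[ k ] m ≡ 2 * k

IsComplete : SGraph → Set
IsComplete G = ∀ a b → a ≢ b → mult G a b ≡ 1

nxt : ℕ → ℕ → ℕ
nxt m k = if suc k ≡ᵇ m then 0 else suc k

-- number of edges between positions i and j of the standard cycle
-- 0 - 1 - ... - (m-1) - 0 on m vertices (for m = 2: two parallel edges)
cycMult : (m : ℕ) → Fin m → Fin m → ℕ
cycMult m i j = length (filterᵇ
  (λ k → ((toℕ i ≡ᵇ k) ∧ (toℕ j ≡ᵇ nxt m k)) ∨ ((toℕ j ≡ᵇ k) ∧ (toℕ i ≡ᵇ nxt m k)))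
  (upTo m))

-- underlying graph is a cycle (length n G ≥ 2; a 2-cycle is a digon):
-- some bijective labelling π of the vertices by 0..n-1 maps the standard cycle onto G
IsCycle : SGraph → Set
IsCycle G = 2 ≤ n G × Σ (Fin (n G) → Fin (n G)) (λ π →
  Injective _≡_ _≡_ π × (∀ i j → mult G (π i) (π j) ≡ cycMult (n G) i j))

Is2K : SGraph → Set
Is2K G = ∀ a b → a ≢ b → posMult G a b ≡ 1 × negMult G a b ≡ 1

Is2C : SGraph → Set
Is2C G = 3 ≤ n G × Σ (Fin (n G) → Fin (n G)) (λ π →
  Injective _≡_ _≡_ π ×
  (∀ i j → posMult G (π i) (π j) ≡ cycMult (n G) i j
         × negMult G (π i) (π j) ≡ cycMult (n G) i j))

-- Lists, colorings, uncolorable pairs.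
-- A list-assignment gives each vertex a finite set of integers, represented
-- by a list (membership = ∈, duplicates irrelevant).

ListAssignment : SGraph → Set
ListAssignment G = Fin (n G) → List ℤ

CardAtLeast : List ℤ → ℕ → Set
CardAtLeast A d = ∃[ B ] (Unique B × length B ≡ d × All (_∈ A) B)

SameSet : List ℤ → List ℤ → Set
SameSet A C = ∀ c → (c ∈ A ⇔ c ∈ C)

neg : List ℤ → List ℤ
neg C = map -_ C

IsColoring : (G : SGraph) → (Fin (n G) → ℤ) → Set
IsColoring G φ = All (λ { (u , w , s) → φ u ≢ act s (φ w) }) (edges G)

IsLColoring : (G : SGraph) → ListAssignment G → (Fin (n G) → ℤ) → Set
IsLColoring G L φ = IsColoring G φ × (∀ v → φ v ∈ L v)

LColorable : (G : SGraph) → ListAssignment G → Set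
LColorable G L = ∃[ φ ] IsLColoring G L φ

UncolorablePair : (G : SGraph) → ListAssignment G → Set
UncolorablePair G L =
  Connected G × (∀ v → CardAtLeast (L v) (deg G v)) × ¬ LColorable G L

-- Necessity.  Let uw be an edge of sign s of an uncolourable brick.  List the other vertices so
-- that each is adjacent to a later one or to w (any order in a complete graph; around the cycle
-- from u's other neighbour towards w).  Colouring u with c ∈ L u and then greedily along the list
-- never gets stuck, so every colour of L w must be forbidden at w: hence |L w| ≤ deg w, and by
-- counting the forbidden colours are exactly L w, among them s·c.  So L v = s·L u along every edge
-- and connectivity spreads one list C over the graph: L v = ±C according to the part of v in a
-- balanced brick, and C = −C when adjacent vertices are joined by edges of both signs, or when the
-- brick is unbalanced (if c ∈ L v but −c ∉ L v, the vertices whose list contains c form a balancing).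
--
-- Sufficiency.  Twisting an L-colouring φ by the parts gives a proper colouring of the underlying
-- complete graph or odd cycle with |C| = Δ colours, which is impossible.  In the doubled bricks |φ|
-- is a proper colouring, needing 2n − 1 elements of a symmetric C for 2K_n and 5 for 2C_n.  In an
-- unbalanced even cycle |C| ≤ 2 forces φ a = −s·φ b on every edge, and together with a 2-colouring
-- of the cycle this yields a balancing.

module Submission where

open import Defs
open import Data.Nat using (ℕ; zero; suc; pred; _+_; _*_; _∸_; _⊔_; _%_; _≤_; _<_; _<?_; _≤?_; z≤n; s≤s; s≤s⁻¹; NonZero; >-nonZero)
open import Data.Nat.DivMod using (m%n<n; %-distribˡ-+; m<n⇒m%n≡m; n%n≡0; [m+n]%n≡m%n; m≤n⇒[n∸m]%m≡n%m)
open import Data.Nat.Properties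
import Data.Nat as ℕ
open import Data.Nat.ListAction using (sum)
open import Algebra.Properties.CommutativeSemigroup +-commutativeSemigroup using (interchange)
open import Data.Bool using (Bool; true; false; not; _∧_; _∨_; _xor_; if_then_else_)
open import Data.Bool.Properties using (∨-identityʳ; ∨-zeroʳ; not-involutive; not-distribˡ-xor; not-distribʳ-xor; T-≡)
open import Data.Fin using (Fin; zero; suc; toℕ; fromℕ<; punchOut)
open import Data.Fin.Properties using (any?; toℕ<n; toℕ-injective; toℕ-fromℕ<; punchOut-injective; injective⇒≤) renaming (_≟_ to _≟F_)
open import Data.Integer using (ℤ; -_; +_; -[1+_]; ∣_∣) renaming (_≟_ to _≟ℤ_)
open import Data.Integer.Properties using (neg-involutive; neg-injective; ∣-i∣≡∣i∣)
open import Data.Sign using (Sign)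
open import Data.List using (List; []; _∷_; length; filter; filterᵇ; map; foldr; allFin; upTo; applyDownFrom; take; _++_)
open import Data.List.Properties using (map-cong; filter-notAll; filter-some; length-++; length-map; length-take; length-tabulate)
open import Data.List.Membership.Propositional using (_∈_; _∉_; find; lose)
open import Data.List.Membership.Propositional.Properties using (∈-filter⁺; ∈-filter⁻; ∈-++⁺ˡ; ∈-++⁺ʳ; ∈-++⁻; ∈-allFin; ∈-upTo⁺; ∈-applyDownFrom⁺; ∈-applyDownFrom⁻; ∈-map⁺; ∈-map⁻)
open import Data.List.Membership.DecPropositional _≟ℤ_ using (_∈?_)
open import Data.List.Relation.Binary.Subset.Propositional using (_⊆_)
open import Data.List.Relation.Unary.Any as Any using (Any; here; there)
open import Data.List.Relation.Unary.All as All using (All; []; _∷_; all?)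
open import Data.List.Relation.Unary.All.Properties using (¬All⇒Any¬)
open import Data.List.Relation.Unary.AllPairs using ([]; _∷_)
open import Data.List.Relation.Unary.Unique.Propositional using (Unique)
import Data.List.Relation.Unary.Unique.Propositional.Properties as Unique
open import Data.Product using (_×_; _,_; ∃-syntax; proj₁; proj₂)
open import Data.Sum using (_⊎_; inj₁; inj₂)
open import Data.Unit using (⊤; tt)
open import Data.Empty using (⊥; ⊥-elim)
open import Function using (_∘_; id; flip; case_of_)
open import Relation.Nullary using (¬_; Dec; does; _×-dec_; yes; no; ⌊_⌋; ¬?; T?; contradiction)
open import Relation.Nullary.Decidable using (dec-true; dec-false; does-⇔)
open import Relation.Binary.Definitions using (DecidableEquality)
open import Relation.Binary.PropositionalEquality using (_≡_; _≢_; refl; sym; trans; cong; cong₂; subst; subst₂; module ≡-Reasoning)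
open import Function.Bundles using (_⇔_; mk⇔; Equivalence)
open import Function.Construct.Identity using (⇔-id)
open import Function.Construct.Composition using (_⇔-∘_)
open import Function.Properties.Equivalence using (⇔-setoid)
open import Level using (0ℓ)
import Relation.Binary.Reasoning.Setoid as ≈-Reasoning

module _ {A : Set} where

  count : (A → Bool) → List A → ℕ
  count p xs = length (filterᵇ p xs)

  count-∷ : ∀ (p : A → Bool) x xs → count p (x ∷ xs) ≡ count p (x ∷ []) + count p xs
  count-∷ p x xs with p x
  ... | true = refl
  ... | false = refl

  count-≥1 : ∀ (p : A → Bool) {xs x} → x ∈ xs → p x ≡ true → 1 ≤ count p xs
  count-≥1 p x∈xs px = filter-some (T? ∘ p) (lose x∈xs (Equivalence.from T-≡ px))

  count-≥1⁻ : ∀ (p : A → Bool) xs → 1 ≤ count p xs → ∃[ x ] (x ∈ xs × p x ≡ true)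
  count-≥1⁻ p xs h with filterᵇ p xs in eq
  ... | x ∷ _ with ∈-filter⁻ (T? ∘ p) {xs = xs} (subst (x ∈_) (sym eq) (here refl))
  ...   | x∈xs , px = x , x∈xs , Equivalence.to T-≡ px

module _ {A : Set} (_≟_ : DecidableEquality A) where

  _without_ : List A → A → List A
  xs without x = filter (λ y → ¬? (y ≟ x)) xs

  ∈-without⁺ : ∀ {xs x y} → y ∈ xs → y ≢ x → y ∈ xs without x
  ∈-without⁺ = ∈-filter⁺ (λ y → ¬? (y ≟ _))

  length-without-< : ∀ {xs x} → x ∈ xs → length (xs without x) < length xs
  length-without-< {xs} x∈xs = filter-notAll (λ y → ¬? (y ≟ _)) xs (Any.map (λ x≡y y≢x → y≢x (sym x≡y)) x∈xs)

  Unique-⊆⇒length-≤ : ∀ {xs ys} → Unique xs → xs ⊆ ys → length xs ≤ length ys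
  Unique-⊆⇒length-≤ {[]} _ _ = z≤n
  Unique-⊆⇒length-≤ {x ∷ xs} (x∉xs ∷ u) xs⊆ys =
    ≤-trans (s≤s (Unique-⊆⇒length-≤ u (λ m → ∈-without⁺ (xs⊆ys (there m)) (λ { refl → All.lookup x∉xs m refl }))))
            (length-without-< (xs⊆ys (here refl)))

  Unique-⊆⇒length-< : ∀ {xs ys y} → Unique xs → xs ⊆ ys → y ∈ ys → y ∉ xs → length xs < length ys
  Unique-⊆⇒length-< u xs⊆ys y∈ys y∉xs =
    ≤-<-trans (Unique-⊆⇒length-≤ u (λ m → ∈-without⁺ (xs⊆ys m) (λ { refl → y∉xs m }))) (length-without-< y∈ys)

length-allFin : ∀ m → length (allFin m) ≡ m
length-allFin m = length-tabulate id

∈-take⁻ : ∀ {A : Set} k (xs : List A) {x} → x ∈ take k xs → x ∈ xs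
∈-take⁻ (suc k) (y ∷ ys) (here refl) = here refl
∈-take⁻ (suc k) (y ∷ ys) (there m) = there (∈-take⁻ k ys m)

module _ {A : Set} where

  length-filter-partition : ∀ {P : A → Set} (P? : ∀ x → Dec (P x)) xs →
    length (filter P? xs) + length (filter (¬? ∘ P?) xs) ≡ length xs
  length-filter-partition P? [] = refl
  length-filter-partition P? (x ∷ xs) with P? x
  ... | yes _ = cong suc (length-filter-partition P? xs)
  ... | no _ = trans (+-suc _ _) (cong suc (length-filter-partition P? xs))

  Unique-constant⇒length≤1 : ∀ {xs : List A} → Unique xs → (∀ {x y} → x ∈ xs → y ∈ xs → x ≡ y) → length xs ≤ 1
  Unique-constant⇒length≤1 {[]} _ _ = z≤n
  Unique-constant⇒length≤1 {_ ∷ []} _ _ = s≤s z≤n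
  Unique-constant⇒length≤1 {_ ∷ _ ∷ _} ((x≢y ∷ _) ∷ _) constant = contradiction (constant (here refl) (there (here refl))) x≢y

module _ {B : Set} where

  sum-map-+ : ∀ (f g : B → ℕ) ws → sum (map (λ w → f w + g w) ws) ≡ sum (map f ws) + sum (map g ws)
  sum-map-+ f g [] = refl
  sum-map-+ f g (w ∷ ws) rewrite sum-map-+ f g ws = interchange (f w) (g w) (sum (map f ws)) (sum (map g ws))

  ∈⇒≤-sum-map : ∀ (f : B → ℕ) {w ws} → w ∈ ws → f w ≤ sum (map f ws)
  ∈⇒≤-sum-map f (here refl) = m≤m+n _ _
  ∈⇒≤-sum-map f {ws = v ∷ _} (there m) = ≤-trans (∈⇒≤-sum-map f m) (m≤n+m _ (f v))

  sum-map-≤-* : ∀ {f : B → ℕ} {c} ws → (∀ {w} → w ∈ ws → f w ≤ c) → sum (map f ws) ≤ length ws * c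
  sum-map-≤-* [] _ = z≤n
  sum-map-≤-* (w ∷ ws) f≤c = +-mono-≤ (f≤c (here refl)) (sum-map-≤-* ws (f≤c ∘ there))

module _ {A : Set} where

  count-≤-sum-counts : ∀ {B : Set} (p : A → Bool) (q : B → A → Bool) (ws : List B) xs →
    (∀ {x} → x ∈ xs → p x ≡ true → ∃[ w ] (w ∈ ws × q w x ≡ true)) →
    count p xs ≤ sum (map (λ w → count (q w) xs) ws)
  count-≤-sum-counts p q ws [] _ = z≤n
  count-≤-sum-counts p q ws (x ∷ xs) covered rewrite count-∷ p x xs = begin
    count p (x ∷ []) + count p xs                                     ≤⟨ +-mono-≤ at-x≤ IH ⟩
    sum (map at-x ws) + sum (map (λ w → count (q w) xs) ws)          ≡⟨ sum-map-+ at-x _ ws ⟨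
    sum (map (λ w → at-x w + count (q w) xs) ws)                     ≡⟨ cong sum (map-cong (λ w → sym (count-∷ (q w) x xs)) ws) ⟩
    sum (map (λ w → count (q w) (x ∷ xs)) ws)                        ∎
    where
    open ≤-Reasoning
    at-x : _ → ℕ
    at-x w = count (q w) (x ∷ [])
    IH : count p xs ≤ sum (map (λ w → count (q w) xs) ws)
    IH = count-≤-sum-counts p q ws xs (covered ∘ there)
    at-x≤ : count p (x ∷ []) ≤ sum (map at-x ws)
    at-x≤ with p x in px
    ... | false = z≤n
    ... | true with covered (here refl) px
    ...   | w , w∈ws , qwx = ≤-trans (count-≥1 (q w) (here refl) qwx) (∈⇒≤-sum-map at-x w∈ws)

injective⇒surjective : ∀ {m} (f : Fin m → Fin m) → (∀ {x y} → f x ≡ f y → x ≡ y) → ∀ y → ∃[ x ] (f x ≡ y)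
injective⇒surjective {suc m} f f-injective y with any? (λ x → f x ≟F y)
... | yes hit = hit
... | no miss = contradiction (injective⇒≤ {f = squeezed} squeezed-injective) 1+n≰n
  where
  squeezed : Fin (suc m) → Fin m
  squeezed x = punchOut {i = y} (λ y≡fx → miss (x , sym y≡fx))
  squeezed-injective : ∀ {x x′} → squeezed x ≡ squeezed x′ → x ≡ x′
  squeezed-injective {x} {x′} =
    f-injective ∘ punchOut-injective {i = y} (λ y≡fx → miss (x , sym y≡fx)) (λ y≡fx → miss (x′ , sym y≡fx))

Fin-one-point : ∀ {m} → m ≡ 1 → (a b : Fin m) → a ≡ b
Fin-one-point refl zero zero = refl

headOr : ∀ {A : Set} → A → List A → A
headOr w [] = w
headOr w (v ∷ _) = v

headOr-All : ∀ {A : Set} {P : A → Set} {w vs} → All P vs → P w → P (headOr w vs)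
headOr-All [] Pw = Pw
headOr-All (Pv ∷ _) _ = Pv

∨-true⁻ : ∀ a {b} → a ∨ b ≡ true → a ≡ true ⊎ b ≡ true
∨-true⁻ true _ = inj₁ refl
∨-true⁻ false h = inj₂ h

∧-true⁻ : ∀ a {b} → a ∧ b ≡ true → a ≡ true × b ≡ true
∧-true⁻ true h = refl , h

≡ᵇ-true⁻ : ∀ {a b} → (a ℕ.≡ᵇ b) ≡ true → a ≡ b
≡ᵇ-true⁻ {a} {b} h = ≡ᵇ⇒≡ a b (Equivalence.from T-≡ h)

≡ᵇ-true : ∀ {a b} → a ≡ b → (a ℕ.≡ᵇ b) ≡ true
≡ᵇ-true {a} {b} a≡b = Equivalence.to T-≡ (≡⇒≡ᵇ a b a≡b)

≟F-true⁻ : ∀ {m} {x y : Fin m} → ⌊ x ≟F y ⌋ ≡ true → x ≡ y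
≟F-true⁻ {x = x} {y} h with x ≟F y
... | yes x≡y = x≡y

≟F-diag : ∀ {m} (x : Fin m) → ⌊ x ≟F x ⌋ ≡ true
≟F-diag x with x ≟F x
... | yes _ = refl
... | no x≢x = contradiction refl x≢x

≟F-≢ : ∀ {m} {x y : Fin m} → x ≢ y → ⌊ x ≟F y ⌋ ≡ false
≟F-≢ {x = x} {y} x≢y with x ≟F y
... | yes x≡y = contradiction x≡y x≢y
... | no _ = refl

isEven : ℕ → Bool
isEven zero = true
isEven (suc k) = not (isEven k)

isEven-2* : ∀ k → isEven (2 * k) ≡ true
isEven-2* zero = refl
isEven-2* (suc k) rewrite +-suc k (k + 0) = trans (not-involutive _) (isEven-2* k)

isEven-even : ∀ {m} → Even m → isEven m ≡ true
isEven-even (k , refl) = isEven-2* k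

isEven-odd : ∀ {m} → Odd m → isEven m ≡ false
isEven-odd (k , refl) = cong not (isEven-2* k)

odd⇒≥3 : ∀ {m} → Odd m → 2 ≤ m → 3 ≤ m
odd⇒≥3 (zero , refl) (s≤s ())
odd⇒≥3 (suc k , refl) _ = s≤s (s≤s (≤-trans (s≤s z≤n) (m≤n+m (suc (k + 0)) k)))

odd-walk-not-2-coloured : ∀ {A : Set} (g : ℕ → A) {m} → Odd m → (∀ k → g k ≢ g (suc k)) →
  (∀ k → g k ≡ g 0 ⊎ g k ≡ g 1) → g m ≢ g 0
odd-walk-not-2-coloured g {m} odd proper two-valued gm≡g0 =
  proper 0 (trans (sym gm≡g0) (subst (λ t → g m ≡ (if t then g 0 else g 1)) (isEven-odd odd) (alternates m)))
  where
  alternates : ∀ k → g k ≡ (if isEven k then g 0 else g 1)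
  alternates zero = refl
  alternates (suc k) with isEven k | alternates k | two-valued (suc k)
  ... | true | gk | inj₁ g1+k = contradiction (trans gk (sym g1+k)) (proper k)
  ... | true | _ | inj₂ g1+k = g1+k
  ... | false | _ | inj₁ g1+k = g1+k
  ... | false | gk | inj₂ g1+k = contradiction (trans gk (sym g1+k)) (proper k)

act-involutive : ∀ s x → act s (act s x) ≡ x
act-involutive Sign.+ x = refl
act-involutive Sign.- x = neg-involutive x

act-0 : ∀ s → act s (+ 0) ≡ + 0
act-0 Sign.+ = refl
act-0 Sign.- = refl

act-injective : ∀ s {x y} → act s x ≡ act s y → x ≡ y
act-injective s {x} {y} eq = trans (sym (act-involutive s x)) (trans (cong (act s) eq) (act-involutive s y))

∈-neg⁺ : ∀ {x C} → - x ∈ C → x ∈ neg C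
∈-neg⁺ {x} {C} m = subst (_∈ neg C) (neg-involutive x) (∈-map⁺ -_ m)

∈-neg⁻ : ∀ {x C} → x ∈ neg C → - x ∈ C
∈-neg⁻ {x} {C} m with ∈-map⁻ -_ m
... | y , y∈C , refl = subst (_∈ C) (sym (neg-involutive y)) y∈C

∈-neg : ∀ {x C} → x ∈ neg C ⇔ - x ∈ C
∈-neg = mk⇔ ∈-neg⁻ ∈-neg⁺

neg-unique : ∀ {C} → Unique C → Unique (neg C)
neg-unique = Unique.map⁺ neg-injective

length-neg : ∀ C → length (neg C) ≡ length C
length-neg = length-map -_

three-distinct : ∀ {C x y z} → Unique C → x ∈ C → y ∈ C → z ∈ C → x ≢ y → x ≢ z → y ≢ z → 3 ≤ length C
three-distinct u x∈C y∈C z∈C x≢y x≢z y≢z = Unique-⊆⇒length-≤ _≟ℤ_ ((x≢y ∷ x≢z ∷ []) ∷ (y≢z ∷ []) ∷ [] ∷ [])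
  λ { (here refl) → x∈C ; (there (here refl)) → y∈C ; (there (there (here refl))) → z∈C }

∣∣-injective± : ∀ a b → ∣ a ∣ ≡ ∣ b ∣ → a ≡ b ⊎ a ≡ - b
∣∣-injective± (+ m) (+ k) eq = inj₁ (cong +_ eq)
∣∣-injective± (+ m) -[1+ k ] eq = inj₂ (cong +_ eq)
∣∣-injective± -[1+ m ] (+ zero) ()
∣∣-injective± -[1+ m ] (+ suc k) eq = inj₂ (cong -[1+_] (suc-injective eq))
∣∣-injective± -[1+ m ] -[1+ k ] eq = inj₁ (cong -[1+_] (suc-injective eq))

≡-neg⇒0 : ∀ {a} → a ≡ - a → a ≡ + 0
≡-neg⇒0 {+ zero} _ = refl

≢0⇒≢-neg : ∀ {a} → a ≢ + 0 → a ≢ - a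
≢0⇒≢-neg a≢0 = a≢0 ∘ ≡-neg⇒0

∣act∣ : ∀ s x → ∣ act s x ∣ ≡ ∣ x ∣
∣act∣ Sign.+ x = refl
∣act∣ Sign.- x = ∣-i∣≡∣i∣ x

∣∣-≢ : ∀ {a b} → ∣ a ∣ ≢ ∣ b ∣ → ∀ s t → act s a ≢ act t b
∣∣-≢ {a} {b} h s t eq = h (trans (sym (∣act∣ s a)) (trans (cong ∣_∣ eq) (∣act∣ t b)))

private
  five-elements : ∀ {C a b c} → Unique C → (∀ {x} → x ∈ C → - x ∈ C) → a ∈ C → b ∈ C → c ∈ C →
    a ≢ + 0 → b ≢ + 0 → ∣ a ∣ ≢ ∣ b ∣ → ∣ a ∣ ≢ ∣ c ∣ → ∣ b ∣ ≢ ∣ c ∣ → 5 ≤ length C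
  five-elements u closed a∈C b∈C c∈C a≢0 b≢0 ab ac bc = Unique-⊆⇒length-≤ _≟ℤ_
    ((≢0⇒≢-neg a≢0 ∷ ∣∣-≢ ab Sign.+ Sign.+ ∷ ∣∣-≢ ab Sign.+ Sign.- ∷ ∣∣-≢ ac Sign.+ Sign.+ ∷ []) ∷
     (∣∣-≢ ab Sign.- Sign.+ ∷ ∣∣-≢ ab Sign.- Sign.- ∷ ∣∣-≢ ac Sign.- Sign.+ ∷ []) ∷
     (≢0⇒≢-neg b≢0 ∷ ∣∣-≢ bc Sign.+ Sign.+ ∷ []) ∷
     (∣∣-≢ bc Sign.- Sign.+ ∷ []) ∷ [] ∷ [])
    λ { (here refl) → a∈C ; (there (here refl)) → closed a∈C ; (there (there (here refl))) → b∈C ;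
        (there (there (there (here refl)))) → closed b∈C ; (there (there (there (there (here refl))))) → c∈C }

  ∣0∣≢⇒≢0 : ∀ {x} → ∣ + 0 ∣ ≢ ∣ x ∣ → x ≢ + 0
  ∣0∣≢⇒≢0 h refl = h refl

three-absolute-values : ∀ {C a b c} → Unique C → (∀ {x} → x ∈ C → - x ∈ C) → a ∈ C → b ∈ C → c ∈ C →
  ∣ a ∣ ≢ ∣ b ∣ → ∣ a ∣ ≢ ∣ c ∣ → ∣ b ∣ ≢ ∣ c ∣ → 5 ≤ length C
three-absolute-values {a = a} {b} u closed a∈C b∈C c∈C ab ac bc with a ≟ℤ + 0 | b ≟ℤ + 0
... | no a≢0 | no b≢0 = five-elements u closed a∈C b∈C c∈C a≢0 b≢0 ab ac bc
... | yes refl | _ = five-elements u closed b∈C c∈C a∈C (∣0∣≢⇒≢0 ab) (∣0∣≢⇒≢0 ac) bc (ab ∘ sym) (ac ∘ sym)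
... | no a≢0 | yes refl = five-elements u closed a∈C c∈C b∈C a≢0 (∣0∣≢⇒≢0 bc) ac ab (bc ∘ sym)

flipBy : Sign → Bool → Bool
flipBy Sign.+ t = t
flipBy Sign.- t = not t

crossing : ∀ {m} (X : Fin m → Bool) a b s → X b ≡ flipBy s (X a) → (s ≡ Sign.- ⇔ crosses X a b ≡ true)
crossing X a b s Xb rewrite Xb with X a | s
... | true | Sign.+ = mk⇔ (λ ()) (λ ())
... | true | Sign.- = mk⇔ (λ _ → refl) (λ _ → refl)
... | false | Sign.+ = mk⇔ (λ ()) (λ ())
... | false | Sign.- = mk⇔ (λ _ → refl) (λ _ → refl)

-- the sign by which the parts X (true) and Y (false) of a balanced graph are twisted
partSign : Bool → Sign
partSign true = Sign.+
partSign false = Sign.-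

signed : Bool → List ℤ → List ℤ
signed true C = C
signed false C = neg C

∈-signed : ∀ t {x C} → x ∈ signed t C ⇔ act (partSign t) x ∈ C
∈-signed true = ⇔-id _
∈-signed false = ∈-neg

signed-unique : ∀ t {C} → Unique C → Unique (signed t C)
signed-unique true u = u
signed-unique false u = neg-unique u

length-signed : ∀ t C → length (signed t C) ≡ length C
length-signed true C = refl
length-signed false C = length-neg C

balanced-twist : ∀ {m} (X : Fin m → Bool) a b s → (s ≡ Sign.- ⇔ crosses X a b ≡ true) →
  ∀ y → act (partSign (X a)) (act s y) ≡ act (partSign (X b)) y
balanced-twist X a b s h y with X a | X b | s
... | true | true | Sign.+ = refl
... | true | true | Sign.- with () ← Equivalence.to h refl
... | true | false | Sign.+ with () ← Equivalence.from h refl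
... | true | false | Sign.- = refl
... | false | true | Sign.+ with () ← Equivalence.from h refl
... | false | true | Sign.- = neg-involutive y
... | false | false | Sign.+ = refl
... | false | false | Sign.- with () ← Equivalence.to h refl

joins⇒ends : ∀ {m} (a b u w : Fin m) {s} → joins a b (u , w , s) ≡ true →
  (u ≡ a × w ≡ b) ⊎ (u ≡ b × w ≡ a)
joins⇒ends a b u w h with ∨-true⁻ (⌊ u ≟F a ⌋ ∧ ⌊ w ≟F b ⌋) h
... | inj₁ h₁ = let p , q = ∧-true⁻ _ h₁ in inj₁ (≟F-true⁻ p , ≟F-true⁻ q)
... | inj₂ h₂ = let p , q = ∧-true⁻ _ h₂ in inj₂ (≟F-true⁻ p , ≟F-true⁻ q)

hasEnd⇒end : ∀ {m} (v u w : Fin m) {s} → hasEnd v (u , w , s) ≡ true → u ≡ v ⊎ w ≡ v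
hasEnd⇒end v u w h with ∨-true⁻ _ h
... | inj₁ p = inj₁ (≟F-true⁻ p)
... | inj₂ q = inj₂ (≟F-true⁻ q)

joins-self : ∀ {m} (a b : Fin m) s → joins a b (a , b , s) ≡ true
joins-self a b s rewrite ≟F-diag a | ≟F-diag b = refl

joins-swap : ∀ {m} (a b : Fin m) s → joins b a (a , b , s) ≡ true
joins-swap a b s rewrite ≟F-diag a | ≟F-diag b = ∨-zeroʳ _

hasEnd-left : ∀ {m} (a b : Fin m) s → hasEnd a (a , b , s) ≡ true
hasEnd-left a b s rewrite ≟F-diag a = refl

hasEnd-right : ∀ {m} (a b : Fin m) s → hasEnd b (a , b , s) ≡ true
hasEnd-right a b s rewrite ≟F-diag b = ∨-zeroʳ _

Vertex : SGraph → Set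
Vertex G = Fin (n G)

module _ {A : Set} (f : A → ℕ) where

  ≤-foldr-⊔ : ∀ {x xs} → x ∈ xs → f x ≤ foldr _⊔_ 0 (map f xs)
  ≤-foldr-⊔ {xs = y ∷ ys} (here refl) = m≤m⊔n (f y) _
  ≤-foldr-⊔ {xs = y ∷ ys} (there m) = ≤-trans (≤-foldr-⊔ m) (m≤n⊔m (f y) _)

  foldr-⊔-lub : ∀ {k} xs → (∀ x → f x ≤ k) → foldr _⊔_ 0 (map f xs) ≤ k
  foldr-⊔-lub [] _ = z≤n
  foldr-⊔-lub (y ∷ ys) h = ⊔-lub (h y) (foldr-⊔-lub ys h)

deg≤Δ : ∀ G v → deg G v ≤ Δ G
deg≤Δ G v = ≤-foldr-⊔ (deg G) (∈-allFin v)

Δ-lub : ∀ G {k} → (∀ v → deg G v ≤ k) → Δ G ≤ k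
Δ-lub G = foldr-⊔-lub (deg G) (allFin (n G))

Δ-regular : ∀ G {k} → 1 ≤ n G → (∀ v → deg G v ≡ k) → Δ G ≡ k
Δ-regular G {k} 1≤n regular = ≤-antisym (Δ-lub G (≤-reflexive ∘ regular))
  (subst (_≤ Δ G) (regular v₀) (deg≤Δ G v₀))
  where v₀ = fromℕ< 1≤n

adjacent-sym : ∀ G {a b} → Adjacent G a b → Adjacent G b a
adjacent-sym G {a} {b} ((u , w , s) , e∈G , j) with joins⇒ends a b u w {s} j
... | inj₁ (refl , refl) = (u , w , s) , e∈G , joins-swap u w s
... | inj₂ (refl , refl) = (u , w , s) , e∈G , joins-self u w s

adjacent⇒≢ : ∀ G {a b} → Adjacent G a b → a ≢ b
adjacent⇒≢ G {a} {b} ((u , w , s) , e∈G , j) with joins⇒ends a b u w {s} j | All.lookup (noLoop G) e∈G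
... | inj₁ (refl , refl) | u≢w = u≢w
... | inj₂ (refl , refl) | u≢w = u≢w ∘ sym

adjacent⇒deg≥1 : ∀ G {u v} → Adjacent G u v → 1 ≤ deg G u
adjacent⇒deg≥1 G {u} {v} ((a , b , s) , e∈G , j) with joins⇒ends u v a b {s} j
... | inj₁ (refl , refl) = count-≥1 (hasEnd a) e∈G (hasEnd-left a b s)
... | inj₂ (refl , refl) = count-≥1 (hasEnd b) e∈G (hasEnd-right a b s)

edge⇒adjacent : ∀ G {a b s} → (a , b , s) ∈ edges G → Adjacent G a b
edge⇒adjacent G {a} {b} {s} e∈G = (a , b , s) , e∈G , joins-self a b s

reach-trans : ∀ G {a b c} → Reach G a b → Reach G b c → Reach G a c
reach-trans G r here = r
reach-trans G r (step r′ adj) = step (reach-trans G r r′) adj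

reach-sym : ∀ G {a b} → Reach G a b → Reach G b a
reach-sym G here = here
reach-sym G (step r adj) = reach-trans G (step here (adjacent-sym G adj)) (reach-sym G r)

connected-from : ∀ G v₀ → (∀ v → Reach G v₀ v) → Connected G
connected-from G v₀ reach a b = reach-trans G (reach-sym G (reach a)) (reach b)

other-vertex : ∀ {m} → 2 ≤ m → (v : Fin m) → ∃[ w ] (w ≢ v)
other-vertex (s≤s (s≤s _)) zero = suc zero , λ ()
other-vertex (s≤s (s≤s _)) (suc _) = zero , λ ()

has-neighbour : ∀ G → Connected G → 2 ≤ n G → ∀ v → ∃[ u ] Adjacent G u v
has-neighbour G conn 2≤n v with other-vertex 2≤n v
... | w , w≢v = last-step (conn w v) w≢v
  where
  last-step : ∀ {x} → Reach G w x → w ≢ x → ∃[ u ] Adjacent G u x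
  last-step here w≢w = contradiction refl w≢w
  last-step (step {b} _ adj) _ = b , adj

propagate : ∀ G (P : Vertex G → Set) → Connected G → ∀ v₀ → P v₀ →
  (∀ {a b s} → (a , b , s) ∈ edges G → (P a → P b) × (P b → P a)) → ∀ v → P v
propagate G P conn v₀ P₀ step-P v = go (conn v₀ v)
  where
  go : ∀ {x} → Reach G v₀ x → P x
  go here = P₀
  go (step {b} {c} r ((u , w , s) , e∈G , j)) with joins⇒ends b c u w {s} j
  ... | inj₁ (refl , refl) = proj₁ (step-P e∈G) (go r)
  ... | inj₂ (refl , refl) = proj₂ (step-P e∈G) (go r)

deg≤sum-mult : ∀ G v ws → (∀ {e} → e ∈ edges G → hasEnd v e ≡ true → ∃[ w ] (w ∈ ws × joins v w e ≡ true)) →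
  deg G v ≤ sum (map (mult G v) ws)
deg≤sum-mult G v ws = count-≤-sum-counts (hasEnd v) (joins v) ws (edges G)

deg≤pred[n]* : ∀ G {c} → (∀ a b → a ≢ b → mult G a b ≤ c) → ∀ v → deg G v ≤ pred (n G) * c
deg≤pred[n]* G {c} mult≤c v = begin
  deg G v                                    ≤⟨ deg≤sum-mult G v others covered ⟩
  sum (map (mult G v) others)                ≤⟨ sum-map-≤-* others (λ w∈ → mult≤c v _ (≢-others w∈ ∘ sym)) ⟩
  length others * c                          ≤⟨ *-monoˡ-≤ c (suc[m]≤n⇒m≤pred[n] (subst (length others <_) (length-allFin (n G))
                                                                (length-without-< _≟F_ (∈-allFin v)))) ⟩
  pred (n G) * c                             ∎
  where
  open ≤-Reasoning
  others : List (Vertex G)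
  others = _without_ _≟F_ (allFin (n G)) v
  ≢-others : ∀ {w} → w ∈ others → w ≢ v
  ≢-others w∈ = proj₂ (∈-filter⁻ (λ y → ¬? (y ≟F v)) {xs = allFin (n G)} w∈)
  covered : ∀ {e} → e ∈ edges G → hasEnd v e ≡ true → ∃[ w ] (w ∈ others × joins v w e ≡ true)
  covered {a , b , s} e∈G at-v with hasEnd⇒end v a b {s} at-v | All.lookup (noLoop G) e∈G
  ... | inj₁ refl | a≢b = b , ∈-without⁺ _≟F_ (∈-allFin b) (a≢b ∘ sym) , joins-self a b s
  ... | inj₂ refl | a≢b = a , ∈-without⁺ _≟F_ (∈-allFin a) a≢b , joins-swap a b s

CompleteAdjacency : SGraph → Set
CompleteAdjacency G = ∀ a b → a ≢ b → Adjacent G a b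

mult≥1⇒adjacent : ∀ G {a b} → 1 ≤ mult G a b → Adjacent G a b
mult≥1⇒adjacent G {a} {b} = count-≥1⁻ (joins a b) (edges G)

adjacent⇒mult≥1 : ∀ G {a b} → Adjacent G a b → 1 ≤ mult G a b
adjacent⇒mult≥1 G {a} {b} (e , e∈G , j) = count-≥1 (joins a b) e∈G j

mult≡posMult+negMult : ∀ G a b → mult G a b ≡ posMult G a b + negMult G a b
mult≡posMult+negMult G a b = go (edges G)
  where
  go : ∀ es → count (joins a b) es ≡
    count (λ e → joins a b e ∧ signIs Sign.+ e) es + count (λ e → joins a b e ∧ signIs Sign.- e) es
  go [] = refl
  go ((u , w , s) ∷ es) with joins a b (u , w , s) | s
  ... | true | Sign.+ = cong suc (go es)
  ... | true | Sign.- = trans (cong suc (go es)) (sym (+-suc _ _))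
  ... | false | _ = go es

BothSigns : SGraph → Set
BothSigns G = ∀ {a b} → Adjacent G a b → ∀ t → ∃[ e ] (e ∈ edges G × joins a b e ≡ true × proj₂ (proj₂ e) ≡ t)

signIs⇒≡ : ∀ {m} t (e : Edge m) → signIs t e ≡ true → proj₂ (proj₂ e) ≡ t
signIs⇒≡ Sign.+ (_ , _ , Sign.+) _ = refl
signIs⇒≡ Sign.- (_ , _ , Sign.-) _ = refl

signed-edge : ∀ G {a b} t → 1 ≤ count (λ e → joins a b e ∧ signIs t e) (edges G) →
  ∃[ e ] (e ∈ edges G × joins a b e ≡ true × proj₂ (proj₂ e) ≡ t)
signed-edge G {a} {b} t h with count-≥1⁻ _ (edges G) h
... | e , e∈G , j∧t = e , e∈G , proj₁ (∧-true⁻ _ j∧t) , signIs⇒≡ t e (proj₂ (∧-true⁻ _ j∧t))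

both-signs : ∀ G → (∀ {a b} → Adjacent G a b → 1 ≤ posMult G a b × 1 ≤ negMult G a b) → BothSigns G
both-signs G signed adj Sign.+ = signed-edge G Sign.+ (proj₁ (signed adj))
both-signs G signed adj Sign.- = signed-edge G Sign.- (proj₂ (signed adj))

complete-connected : ∀ G → CompleteAdjacency G → Connected G
complete-connected G complete a b with a ≟F b
... | yes refl = here
... | no a≢b = step here (complete a b a≢b)

LargeLists : (G : SGraph) → ListAssignment G → Set
LargeLists G L = ∀ v → CardAtLeast (L v) (deg G v)

CardAtMost : List ℤ → ℕ → Set
CardAtMost A d = ∀ D → Unique D → D ⊆ A → length D ≤ d

SignedCopyLists : (G : SGraph) → ListAssignment G → (Vertex G → Bool) → Set
SignedCopyLists G L X = ∃[ C ] (Unique C × length C ≡ Δ G ×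
  (∀ v → X v ≡ true → SameSet (L v) C) × (∀ v → X v ≡ false → SameSet (L v) (neg C)))

SymmetricLists : (G : SGraph) → ListAssignment G → Set
SymmetricLists G L = ∃[ C ] (Unique C × length C ≡ Δ G × SameSet C (neg C) × (∀ v → SameSet (L v) C))

Δ-from-lists : ∀ G L {k} → 1 ≤ n G → LargeLists G L → (∀ v → CardAtMost (L v) (deg G v)) →
  (∀ v → ∃[ D ] (Unique D × length D ≡ k × SameSet (L v) D)) → Δ G ≡ k
Δ-from-lists G L {k} 1≤n large bounded lists = Δ-regular G 1≤n deg≡k
  where
  deg≡k : ∀ v → deg G v ≡ k
  deg≡k v with lists v | large v
  ... | D , unique-D , |D|≡k , Lv≈D | B , unique-B , |B|≡deg , B⊆Lv = ≤-antisym
    (subst₂ _≤_ |B|≡deg |D|≡k (Unique-⊆⇒length-≤ _≟ℤ_ unique-B (λ m → Equivalence.to (Lv≈D _) (All.lookup B⊆Lv m))))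
    (subst (_≤ deg G v) |D|≡k (bounded v D unique-D (λ m → Equivalence.from (Lv≈D _) m)))

maximal-⊇ : ∀ {A B} {d : ℕ} → Unique B → B ⊆ A → length B ≡ d → CardAtMost A d → A ⊆ B
maximal-⊇ {A} {B} {d} unique-B B⊆A |B|≡d bounded {x} x∈A with x ∈? B
... | yes x∈B = x∈B
... | no x∉B = contradiction (subst (λ k → suc k ≤ d) |B|≡d
                   (bounded (x ∷ B) (All.tabulate (λ { m refl → x∉B m }) ∷ unique-B) x∷B⊆A)) 1+n≰n
  where
  x∷B⊆A : x ∷ B ⊆ A
  x∷B⊆A (here refl) = x∈A
  x∷B⊆A (there m) = B⊆A m

large-if-Δ≤ : ∀ G L → (∀ v → ∃[ D ] (Unique D × Δ G ≤ length D × D ⊆ L v)) → LargeLists G L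
large-if-Δ≤ G L lists v with lists v
... | D , unique-D , Δ≤|D| , D⊆Lv = take (deg G v) D , Unique.take⁺ (deg G v) unique-D ,
  trans (length-take (deg G v) D) (m≤n⇒m⊓n≡m (≤-trans (deg≤Δ G v) Δ≤|D|)) ,
  All.tabulate (D⊆Lv ∘ ∈-take⁻ (deg G v) D)

-- Necessity

LeadsTo : ∀ G → List (Vertex G) → Vertex G → Set
LeadsTo G [] w = ⊤
LeadsTo G (v ∷ vs) w = Adjacent G v (headOr w vs) × LeadsTo G vs w

record Ordering (G : SGraph) (u w : Vertex G) : Set where
  field
    order : List (Vertex G)
    unique : Unique order
    avoids-first : All (_≢ u) order
    avoids-last : w ∉ order
    leads : LeadsTo G order w
    covers : ∀ x → x ≢ w → x ≡ u ⊎ x ∈ order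

EdgeOrderings : SGraph → Set
EdgeOrderings G = ∀ {u w} → Adjacent G u w → Ordering G u w

module GreedyColouring (G : SGraph) (L : ListAssignment G) where

  private
    V = Vertex G
    E = Edge (n G)

  _∪｛_｝ : (V → Bool) → V → V → Bool
  (S ∪｛ v ｝) x = S x ∨ ⌊ x ≟F v ⌋

  _[_≔_] : (V → ℤ) → V → ℤ → V → ℤ
  (φ [ v ≔ c ]) x = if ⌊ x ≟F v ⌋ then c else φ x

  ∪｛｝-other : ∀ S {v x} → x ≢ v → (S ∪｛ v ｝) x ≡ S x
  ∪｛｝-other S {v} {x} x≢v rewrite ≟F-≢ x≢v = ∨-identityʳ (S x)

  ∪｛｝-old : ∀ S {v x} → S x ≡ true → (S ∪｛ v ｝) x ≡ true
  ∪｛｝-old S Sx rewrite Sx = refl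

  ∪｛｝-new : ∀ S v → (S ∪｛ v ｝) v ≡ true
  ∪｛｝-new S v rewrite ≟F-diag v = ∨-zeroʳ (S v)

  ≔-other : ∀ φ {v c x} → x ≢ v → (φ [ v ≔ c ]) x ≡ φ x
  ≔-other φ x≢v rewrite ≟F-≢ x≢v = refl

  -- a partial colouring: S is the set of coloured vertices, φ their colours
  ProperAt : (V → Bool) → (V → ℤ) → E → Set
  ProperAt S φ (a , b , s) = S a ≡ true → S b ≡ true → φ a ≢ act s (φ b)

  FromLists : (V → Bool) → (V → ℤ) → Set
  FromLists S φ = ∀ x → S x ≡ true → φ x ∈ L x

  Loopless : E → Set
  Loopless (a , b , _) = a ≢ b

  loopless : All Loopless (edges G)
  loopless = All.map (λ { {_ , _ , _} a≢b → a≢b }) (noLoop G)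

  forbidden₁ : V → (V → Bool) → (V → ℤ) → E → List ℤ
  forbidden₁ v S φ (a , b , s) with a ≟F v | b ≟F v
  ... | yes _ | _ = if S b then act s (φ b) ∷ [] else []
  ... | no _ | yes _ = if S a then act s (φ a) ∷ [] else []
  ... | no _ | no _ = []

  forbidden : V → (V → Bool) → (V → ℤ) → List E → List ℤ
  forbidden v S φ [] = []
  forbidden v S φ (e ∷ es) = forbidden₁ v S φ e ++ forbidden v S φ es

  ToUncoloured : V → (V → Bool) → E → Set
  ToUncoloured v S (a , b , _) = (a ≡ v × S b ≡ false) ⊎ (b ≡ v × S a ≡ false)

  private
    length-forbidden₁-≤ : ∀ v S φ e → length (forbidden₁ v S φ e) ≤ count (hasEnd v) (e ∷ [])
    length-forbidden₁-≤ v S φ (a , b , s) with a ≟F v | b ≟F v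
    ... | yes _ | _ with S b
    ...   | true = ≤-refl
    ...   | false = z≤n
    length-forbidden₁-≤ v S φ (a , b , s) | no _ | yes _ with S a
    ...   | true = ≤-refl
    ...   | false = z≤n
    length-forbidden₁-≤ v S φ (a , b , s) | no _ | no _ = z≤n

    length-forbidden₁-< : ∀ v S φ e → ToUncoloured v S e → length (forbidden₁ v S φ e) < count (hasEnd v) (e ∷ [])
    length-forbidden₁-< v S φ (a , b , s) (inj₁ (refl , Sb)) with a ≟F a
    ... | yes _ rewrite Sb = s≤s z≤n
    ... | no a≢a = contradiction refl a≢a
    length-forbidden₁-< v S φ (a , b , s) (inj₂ (refl , Sa)) with a ≟F b | b ≟F b
    ... | yes refl | _ rewrite Sa = s≤s z≤n
    ... | no _ | yes _ rewrite Sa = s≤s z≤n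
    ... | no _ | no b≢b = contradiction refl b≢b

  length-forbidden-≤ : ∀ v S φ es → length (forbidden v S φ es) ≤ count (hasEnd v) es
  length-forbidden-≤ v S φ [] = z≤n
  length-forbidden-≤ v S φ (e ∷ es) rewrite length-++ (forbidden₁ v S φ e) {forbidden v S φ es} | count-∷ (hasEnd v) e es =
    +-mono-≤ (length-forbidden₁-≤ v S φ e) (length-forbidden-≤ v S φ es)

  length-forbidden-< : ∀ v S φ es → Any (ToUncoloured v S) es → length (forbidden v S φ es) < count (hasEnd v) es
  length-forbidden-< v S φ (e ∷ es) unc rewrite length-++ (forbidden₁ v S φ e) {forbidden v S φ es} | count-∷ (hasEnd v) e es
    with unc
  ... | here u = +-mono-<-≤ (length-forbidden₁-< v S φ e u) (length-forbidden-≤ v S φ es)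
  ... | there u = +-mono-≤-< (length-forbidden₁-≤ v S φ e) (length-forbidden-< v S φ es u)

  ∈-forbidden : ∀ {w S φ es a b s} → (a , b , s) ∈ es →
    (a ≡ w → S b ≡ true → act s (φ b) ∈ forbidden w S φ es) ×
    (b ≡ w → a ≢ w → S a ≡ true → act s (φ a) ∈ forbidden w S φ es)
  ∈-forbidden {es = e ∷ es} (there m) =
    (λ p q → ∈-++⁺ʳ (forbidden₁ _ _ _ e) (proj₁ (∈-forbidden m) p q)) ,
    (λ p q r → ∈-++⁺ʳ (forbidden₁ _ _ _ e) (proj₂ (∈-forbidden m) p q r))
  ∈-forbidden {w} {S} {φ} {es = (a , b , s) ∷ es} (here refl) = first , second
    where
    first : a ≡ w → S b ≡ true → act s (φ b) ∈ forbidden w S φ ((a , b , s) ∷ es)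
    first a≡w Sb with a ≟F w
    ... | no a≢w = contradiction a≡w a≢w
    ... | yes _ rewrite Sb = here refl
    second : b ≡ w → a ≢ w → S a ≡ true → act s (φ a) ∈ forbidden w S φ ((a , b , s) ∷ es)
    second b≡w a≢w Sa with a ≟F w | b ≟F w
    ... | yes a≡w | _ = contradiction a≡w a≢w
    ... | no _ | no b≢w = contradiction b≡w b≢w
    ... | no _ | yes _ rewrite Sa = here refl

  private
    ∈-if : ∀ {t} {x y : ℤ} → t ≡ true → x ≡ y → x ∈ (if t then y ∷ [] else [])
    ∈-if refl x≡y = here x≡y

    ∨-false⁻ : ∀ t → t ∨ false ≡ true → t ≡ true
    ∨-false⁻ t = trans (sym (∨-identityʳ t))

  extend-proper₁ : ∀ S φ v c e → Loopless e → ProperAt S φ e → S v ≡ false → c ∉ forbidden₁ v S φ e →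
    ProperAt (S ∪｛ v ｝) (φ [ v ≔ c ]) e
  extend-proper₁ S φ v c (a , b , s) a≢b proper Sv c∉ with a ≟F v | b ≟F v
  ... | yes refl | yes refl = contradiction refl a≢b
  ... | yes refl | no _ = λ _ Sb c≡ → c∉ (∈-if (∨-false⁻ (S b) Sb) c≡)
  ... | no _ | yes refl = λ Sa _ c≡ →
    c∉ (∈-if (∨-false⁻ (S a) Sa) (trans (sym (act-involutive s c)) (cong (act s) (sym c≡))))
  ... | no _ | no _ = λ Sa Sb → proper (∨-false⁻ (S a) Sa) (∨-false⁻ (S b) Sb)

  extend-proper : ∀ S φ v c es → All Loopless es → All (ProperAt S φ) es → S v ≡ false → c ∉ forbidden v S φ es →
    All (ProperAt (S ∪｛ v ｝) (φ [ v ≔ c ])) es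
  extend-proper S φ v c [] _ _ _ _ = []
  extend-proper S φ v c (e ∷ es) (ll ∷ lls) (p ∷ ps) Sv c∉ =
    extend-proper₁ S φ v c e ll p Sv (c∉ ∘ ∈-++⁺ˡ) ∷
    extend-proper S φ v c es lls ps Sv (c∉ ∘ ∈-++⁺ʳ (forbidden₁ v S φ e))

  extend-lists : ∀ {S φ v c} → FromLists S φ → c ∈ L v → FromLists (S ∪｛ v ｝) (φ [ v ≔ c ])
  extend-lists {S} {v = v} from c∈Lv x Sx′ with x ≟F v
  ... | yes refl = c∈Lv
  ... | no _ = from x (∨-false⁻ (S x) Sx′)

  free-colour : LargeLists G L → ∀ v S φ → Any (ToUncoloured v S) (edges G) →
    ∃[ c ] (c ∈ L v × c ∉ forbidden v S φ (edges G))
  free-colour large v S φ unc with large v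
  ... | B , unique-B , |B|≡deg , B⊆Lv with all? (_∈? forbidden v S φ (edges G)) B
  ... | yes B⊆F = contradiction (Unique-⊆⇒length-≤ _≟ℤ_ unique-B (All.lookup B⊆F))
        (<⇒≱ (subst (length (forbidden v S φ (edges G)) <_) (sym |B|≡deg) (length-forbidden-< v S φ (edges G) unc)))
  ... | no B⊈F with find (¬All⇒Any¬ (_∈? forbidden v S φ (edges G)) B B⊈F)
  ...   | c , c∈B , c∉F = c , All.lookup B⊆Lv c∈B , c∉F

  colourAll : List V → (V → Bool) → V → Bool
  colourAll [] S = S
  colourAll (v ∷ vs) S = colourAll vs (S ∪｛ v ｝)

  -- every vertex, when its turn comes, still has an uncoloured neighbour
  GreedyOrder : List V → (V → Bool) → Set
  GreedyOrder [] S = ⊤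
  GreedyOrder (v ∷ vs) S = S v ≡ false × Any (ToUncoloured v S) (edges G) × GreedyOrder vs (S ∪｛ v ｝)

  greedy-extend : LargeLists G L → ∀ vs S φ → All (ProperAt S φ) (edges G) → FromLists S φ → GreedyOrder vs S →
    ∃[ φ′ ] (All (ProperAt (colourAll vs S) φ′) (edges G) × FromLists (colourAll vs S) φ′ ×
             (∀ x → S x ≡ true → φ′ x ≡ φ x))
  greedy-extend large [] S φ proper from _ = φ , proper , from , λ _ _ → refl
  greedy-extend large (v ∷ vs) S φ proper from (Sv , unc , order) with free-colour large v S φ unc
  ... | c , c∈Lv , c∉F with greedy-extend large vs (S ∪｛ v ｝) (φ [ v ≔ c ])
                               (extend-proper S φ v c (edges G) loopless proper Sv c∉F) (extend-lists from c∈Lv) order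
  ... | φ′ , proper′ , from′ , keeps = φ′ , proper′ , from′ ,
        λ x Sx → trans (keeps x (∪｛｝-old S Sx)) (≔-other φ (λ { refl → contradiction (trans (sym Sx) Sv) λ () }))

  complete-colouring : ∀ S φ w → All (ProperAt S φ) (edges G) → FromLists S φ → S w ≡ false →
    (∀ x → x ≢ w → S x ≡ true) → ∀ {c} → c ∈ L w → c ∉ forbidden w S φ (edges G) → LColorable G L
  complete-colouring S φ w proper from Sw others {c} c∈Lw c∉F = φ [ w ≔ c ] , colouring , in-lists
    where
    everything : ∀ x → (S ∪｛ w ｝) x ≡ true
    everything x with x ≟F w
    ... | yes refl = ∨-zeroʳ (S x)
    ... | no x≢w = trans (∨-identityʳ (S x)) (others x x≢w)
    colouring : IsColoring G (φ [ w ≔ c ])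
    colouring = All.map (λ { {a , b , s} p → p (everything a) (everything b) })
                        (extend-proper S φ w c (edges G) loopless proper Sw c∉F)
    in-lists : ∀ v → (φ [ w ≔ c ]) v ∈ L v
    in-lists = λ v → extend-lists from c∈Lw v (everything v)

  colourAll-true : ∀ vs S {x} → S x ≡ true ⊎ x ∈ vs → colourAll vs S x ≡ true
  colourAll-true [] S (inj₁ Sx) = Sx
  colourAll-true (v ∷ vs) S (inj₁ Sx) = colourAll-true vs (S ∪｛ v ｝) (inj₁ (∪｛｝-old S Sx))
  colourAll-true (v ∷ vs) S (inj₂ (here refl)) = colourAll-true vs (S ∪｛ v ｝) (inj₁ (∪｛｝-new S v))
  colourAll-true (v ∷ vs) S (inj₂ (there x∈vs)) = colourAll-true vs (S ∪｛ v ｝) (inj₂ x∈vs)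

  colourAll-false : ∀ vs S {x} → S x ≡ false → x ∉ vs → colourAll vs S x ≡ false
  colourAll-false [] S Sx _ = Sx
  colourAll-false (v ∷ vs) S Sx x∉ =
    colourAll-false vs (S ∪｛ v ｝) (trans (∪｛｝-other S (x∉ ∘ here)) Sx) (x∉ ∘ there)

  leads⇒greedy : ∀ {w} vs S → Unique vs → All (λ x → S x ≡ false) vs → S w ≡ false → w ∉ vs →
    LeadsTo G vs w → GreedyOrder vs S
  leads⇒greedy [] S _ _ _ _ _ = tt
  leads⇒greedy {w} (v ∷ vs) S (v∉vs ∷ unique) (Sv ∷ uncoloured) Sw w∉ (adj , leads) =
    Sv , toUncoloured adj ,
    leads⇒greedy vs (S ∪｛ v ｝) unique uncoloured′ (trans (∪｛｝-other S (w∉ ∘ here)) Sw) (w∉ ∘ there) leads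
    where
    next-uncoloured : S (headOr w vs) ≡ false
    next-uncoloured = headOr-All uncoloured Sw
    toUncoloured : Adjacent G v (headOr w vs) → Any (ToUncoloured v S) (edges G)
    toUncoloured ((a , b , s) , e∈G , j) with joins⇒ends v (headOr w vs) a b {s} j
    ... | inj₁ (refl , refl) = lose e∈G (inj₁ (refl , next-uncoloured))
    ... | inj₂ (refl , refl) = lose e∈G (inj₂ (refl , next-uncoloured))
    uncoloured′ : All (λ x → (S ∪｛ v ｝) x ≡ false) vs
    uncoloured′ = All.zipWith (λ { (v≢x , Sx) → trans (∪｛｝-other S (v≢x ∘ sym)) Sx }) (v∉vs , uncoloured)

  -- Colour u with c and then the ordering greedily: every vertex but w gets a colour, and
  -- uncolourability forces every colour of L w to be forbidden at w.
  module Saturation (uncolourable : ¬ LColorable G L) (large : LargeLists G L)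
                    {u w : V} (u≢w : u ≢ w) (ord : Ordering G u w) {c : ℤ} (c∈Lu : c ∈ L u) where
    open Ordering ord

    private
      S₀ : V → Bool
      S₀ x = ⌊ x ≟F u ⌋

      S₀-false : ∀ {x} → x ≢ u → S₀ x ≡ false
      S₀-false = ≟F-≢

      proper₀ : All (ProperAt S₀ (λ _ → c)) (edges G)
      proper₀ = All.map (λ { {a , b , s} a≢b Sa Sb _ → a≢b (trans (≟F-true⁻ Sa) (sym (≟F-true⁻ Sb))) }) loopless

      from₀ : FromLists S₀ (λ _ → c)
      from₀ x Sx with ≟F-true⁻ {x = x} Sx
      ... | refl = c∈Lu

      S : V → Bool
      S = colourAll order S₀

      extended : ∃[ φ ] (All (ProperAt S φ) (edges G) × FromLists S φ × (∀ x → S₀ x ≡ true → φ x ≡ c))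
      extended = greedy-extend large order S₀ (λ _ → c) proper₀ from₀
        (leads⇒greedy order S₀ unique (All.map S₀-false avoids-first) (S₀-false (u≢w ∘ sym)) avoids-last leads)

      φ : V → ℤ
      φ = proj₁ extended

      F : List ℤ
      F = forbidden w S φ (edges G)

      Sw : S w ≡ false
      Sw = colourAll-false order S₀ (S₀-false (u≢w ∘ sym)) avoids-last

      S-others : ∀ x → x ≢ w → S x ≡ true
      S-others x x≢w with covers x x≢w
      ... | inj₁ refl = colourAll-true order S₀ (inj₁ (≟F-diag x))
      ... | inj₂ x∈order = colourAll-true order S₀ (inj₂ x∈order)

      φu : φ u ≡ c
      φu = proj₂ (proj₂ (proj₂ extended)) u (≟F-diag u)

      Lw⊆F : L w ⊆ F
      Lw⊆F {c′} c′∈Lw with c′ ∈? F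
      ... | yes c′∈F = c′∈F
      ... | no c′∉F = contradiction
              (complete-colouring S φ w (proj₁ (proj₂ extended)) (proj₁ (proj₂ (proj₂ extended))) Sw S-others c′∈Lw c′∉F)
              uncolourable

      |F|≤deg : length F ≤ deg G w
      |F|≤deg = length-forbidden-≤ w S φ (edges G)

    lists-bounded : CardAtMost (L w) (deg G w)
    lists-bounded D unique-D D⊆Lw = ≤-trans (Unique-⊆⇒length-≤ _≟ℤ_ unique-D (Lw⊆F ∘ D⊆Lw)) |F|≤deg

    private
      F⊆Lw : F ⊆ L w
      F⊆Lw {y} y∈F with large w
      ... | B , unique-B , |B|≡deg , B⊆Lw with y ∈? B
      ...   | yes y∈B = All.lookup B⊆Lw y∈B
      ...   | no y∉B = contradiction (subst (length F ≤_) (sym |B|≡deg) |F|≤deg)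
                (<⇒≱ (Unique-⊆⇒length-< _≟ℤ_ unique-B (Lw⊆F ∘ All.lookup B⊆Lw) y∈F y∉B))

    colour-forced : ∀ {a b s} → (a , b , s) ∈ edges G → (a ≡ u × b ≡ w) ⊎ (a ≡ w × b ≡ u) → act s c ∈ L w
    colour-forced {s = s} e∈G (inj₁ (refl , refl)) =
      F⊆Lw (subst (λ x → act s x ∈ F) φu (proj₂ (∈-forbidden e∈G) refl u≢w (S-others u u≢w)))
    colour-forced {s = s} e∈G (inj₂ (refl , refl)) =
      F⊆Lw (subst (λ x → act s x ∈ F) φu (proj₁ (∈-forbidden e∈G) refl (S-others u u≢w)))

module ForcedLists (G : SGraph) (L : ListAssignment G) (uncolourable-pair : UncolorablePair G L)
                   (2≤n : 2 ≤ n G) (orderings : EdgeOrderings G) where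
  open GreedyColouring G L

  private
    V = Vertex G
    conn : Connected G
    conn = proj₁ uncolourable-pair
    large : LargeLists G L
    large = proj₁ (proj₂ uncolourable-pair)
    uncolourable : ¬ LColorable G L
    uncolourable = proj₂ (proj₂ uncolourable-pair)

  transport : ∀ {a b s x} → (a , b , s) ∈ edges G → x ∈ L a → act s x ∈ L b
  transport e∈G x∈La = Saturation.colour-forced uncolourable large (adjacent⇒≢ G adj) (orderings adj) x∈La e∈G (inj₁ (refl , refl))
    where adj = edge⇒adjacent G e∈G

  transport⁻ : ∀ {a b s x} → (a , b , s) ∈ edges G → x ∈ L b → act s x ∈ L a
  transport⁻ e∈G x∈Lb = Saturation.colour-forced uncolourable large (adjacent⇒≢ G adj) (orderings adj) x∈Lb e∈G (inj₂ (refl , refl))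
    where adj = adjacent-sym G (edge⇒adjacent G e∈G)

  edge-⇔ : ∀ {a b s} → (a , b , s) ∈ edges G → ∀ y → y ∈ L b ⇔ act s y ∈ L a
  edge-⇔ {b = b} {s} e∈G y = mk⇔ (transport⁻ e∈G) (λ m → subst (_∈ L b) (act-involutive s y) (transport e∈G m))

  edge-⇔⁻ : ∀ {a b s} → (a , b , s) ∈ edges G → ∀ y → y ∈ L a ⇔ act s y ∈ L b
  edge-⇔⁻ {a} {s = s} e∈G y = mk⇔ (transport e∈G) (λ m → subst (_∈ L a) (act-involutive s y) (transport⁻ e∈G m))

  along : ∀ {a b} e → e ∈ edges G → joins a b e ≡ true → ∀ {x} → x ∈ L a → act (proj₂ (proj₂ e)) x ∈ L b
  along {a} {b} (u , w , s) e∈G j with joins⇒ends a b u w {s} j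
  ... | inj₁ (refl , refl) = transport e∈G
  ... | inj₂ (refl , refl) = transport⁻ e∈G

  bounded : ∀ v → CardAtMost (L v) (deg G v)
  bounded v with has-neighbour G conn 2≤n v
  ... | u , adj with large u
  ...   | B , _ , |B|≡deg , B⊆Lu = from-colour B B⊆Lu |B|≡deg
    where
    from-colour : ∀ B → All (_∈ L u) B → length B ≡ deg G u → CardAtMost (L v) (deg G v)
    from-colour [] _ |B|≡deg = contradiction (sym |B|≡deg) (<⇒≢ (adjacent⇒deg≥1 G adj) ∘ sym)
    from-colour (c ∷ _) (c∈Lu ∷ _) _ = Saturation.lists-bounded uncolourable large (adjacent⇒≢ G adj) (orderings adj) c∈Lu

  private
    v₀ : V
    v₀ = fromℕ< (≤-trans (s≤s z≤n) 2≤n)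

    B₀ : List ℤ
    B₀ = proj₁ (large v₀)

    unique-B₀ : Unique B₀
    unique-B₀ = proj₁ (proj₂ (large v₀))

    Lv₀≈B₀ : SameSet (L v₀) B₀
    Lv₀≈B₀ x =
      mk⇔ (maximal-⊇ unique-B₀ (All.lookup B₀⊆Lv₀) (proj₁ (proj₂ (proj₂ (large v₀)))) (bounded v₀)) (All.lookup B₀⊆Lv₀)
      where B₀⊆Lv₀ = proj₂ (proj₂ (proj₂ (large v₀)))

    Δ≡ : ∀ {k} → (∀ v → ∃[ D ] (Unique D × length D ≡ k × SameSet (L v) D)) → Δ G ≡ k
    Δ≡ = Δ-from-lists G L (≤-trans (s≤s z≤n) 2≤n) large bounded

  signed-copies : ∀ X → BalancedWith G X → SignedCopyLists G L X
  signed-copies X balanced = C , signed-unique (X v₀) unique-B₀ ,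
    sym (Δ≡ (λ v → signed (X v) C , signed-unique (X v) (signed-unique (X v₀) unique-B₀) , length-signed (X v) C , P-all v)) ,
    (λ v Xv → subst (λ t → SameSet (L v) (signed t C)) Xv (P-all v)) ,
    (λ v Xv → subst (λ t → SameSet (L v) (signed t C)) Xv (P-all v))
    where
    C : List ℤ
    C = signed (X v₀) B₀
    ε : V → Sign
    ε v = partSign (X v)

    P : V → Set
    P v = SameSet (L v) (signed (X v) C)

    P₀ : P v₀
    P₀ x = begin
      x ∈ L v₀                                   ≈⟨ Lv₀≈B₀ x ⟩
      x ∈ B₀                                     ≡⟨ cong (_∈ B₀) (act-involutive (ε v₀) x) ⟨
      act (ε v₀) (act (ε v₀) x) ∈ B₀             ≈⟨ ∈-signed (X v₀) ⟨
      act (ε v₀) x ∈ C                           ≈⟨ ∈-signed (X v₀) ⟨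
      x ∈ signed (X v₀) C                        ∎
      where open ≈-Reasoning (⇔-setoid 0ℓ)

    shift : ∀ {p q s} → (∀ y → y ∈ L q ⇔ act s y ∈ L p) →
      (∀ y → act (ε p) (act s y) ≡ act (ε q) y) → P p → P q
    shift {p} {q} {s} edge twist Pp x = begin
      x ∈ L q                     ≈⟨ edge x ⟩
      act s x ∈ L p               ≈⟨ Pp (act s x) ⟩
      act s x ∈ signed (X p) C    ≈⟨ ∈-signed (X p) ⟩
      act (ε p) (act s x) ∈ C     ≡⟨ cong (_∈ C) (twist x) ⟩
      act (ε q) x ∈ C             ≈⟨ ∈-signed (X q) ⟨
      x ∈ signed (X q) C          ∎
      where open ≈-Reasoning (⇔-setoid 0ℓ)

    P-all : ∀ v → P v
    P-all = propagate G P conn v₀ P₀ λ {a} {b} {s} e∈G →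
      let twist = balanced-twist X a b s (All.lookup balanced e∈G) in
      shift {s = s} (edge-⇔ e∈G) twist ,
      shift {s = s} (edge-⇔⁻ e∈G) (λ y → trans (sym (twist (act s y))) (cong (act (ε a)) (act-involutive s y)))

  private
    symmetric-lists : (∀ {x} → x ∈ L v₀ → - x ∈ L v₀) → (∀ v → SameSet (L v) (L v₀)) → SymmetricLists G L
    symmetric-lists closed₀ same = B₀ , unique-B₀ ,
      sym (Δ≡ λ v → B₀ , unique-B₀ , refl , λ x → Lv₀≈B₀ x ⇔-∘ same v x) ,
      (λ x → mk⇔ (λ x∈B₀ → ∈-neg⁺ (to₀ (closed₀ (from₀ x∈B₀))))
                 (λ x∈-B₀ → subst (_∈ B₀) (neg-involutive x) (to₀ (closed₀ (from₀ (∈-neg⁻ x∈-B₀)))))) ,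
      λ v x → Lv₀≈B₀ x ⇔-∘ same v x
      where
      to₀ : ∀ {x} → x ∈ L v₀ → x ∈ B₀
      to₀ {x} = Equivalence.to (Lv₀≈B₀ x)
      from₀ : ∀ {x} → x ∈ B₀ → x ∈ L v₀
      from₀ {x} = Equivalence.from (Lv₀≈B₀ x)

  symmetric-if-both-signs : BothSigns G → SymmetricLists G L
  symmetric-if-both-signs both = symmetric-lists closed₀ same
    where
    via : ∀ {a b} → Adjacent G a b → ∀ t {x} → x ∈ L a → act t x ∈ L b
    via adj t with both adj t
    ... | e , e∈G , j , refl = along e e∈G j

    same : ∀ v → SameSet (L v) (L v₀)
    same = propagate G (λ v → SameSet (L v) (L v₀)) conn v₀ (λ _ → ⇔-id _) λ e∈G →
      let adj = edge⇒adjacent G e∈G ; adj⁻ = adjacent-sym G adj in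
      (λ same-a x → same-a x ⇔-∘ mk⇔ (via adj⁻ Sign.+) (via adj Sign.+)) ,
      (λ same-b x → same-b x ⇔-∘ mk⇔ (via adj Sign.+) (via adj⁻ Sign.+))

    closed₀ : ∀ {x} → x ∈ L v₀ → - x ∈ L v₀
    closed₀ {x} x∈Lv₀ with has-neighbour G conn 2≤n v₀
    ... | u , adj = Equivalence.to (same u (- x)) (via (adjacent-sym G adj) Sign.- x∈Lv₀)

  ∈?-edge : ∀ {a b s} → (a , b , s) ∈ edges G → ∀ y → does (y ∈? L b) ≡ does (act s y ∈? L a)
  ∈?-edge {a} {b} {s} e∈G y = does-⇔ (edge-⇔ e∈G y) (y ∈? L b) (act s y ∈? L a)

  ∈?-edge⁻ : ∀ {a b s} → (a , b , s) ∈ edges G → ∀ y → does (y ∈? L a) ≡ does (act s y ∈? L b)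
  ∈?-edge⁻ {a} {b} {s} e∈G y = does-⇔ (edge-⇔⁻ e∈G y) (y ∈? L a) (act s y ∈? L b)

  -- If exactly one of ± c lies in L v, the same holds at every vertex, and the vertices whose
  -- list contains c form one part of a balancing.
  neg-closed-if-unbalanced : ¬ Balanced G → ∀ v {c} → c ∈ L v → - c ∈ L v
  neg-closed-if-unbalanced unbalanced v {c} c∈Lv with - c ∈? L v
  ... | yes -c∈Lv = -c∈Lv
  ... | no -c∉Lv = contradiction (X , balanced) unbalanced
    where
    X : V → Bool
    X x = does (c ∈? L x)

    Q : V → Set
    Q x = does (- c ∈? L x) ≡ not (X x)

    Q-step : ∀ {p q} s → (∀ y → does (y ∈? L q) ≡ does (act s y ∈? L p)) → Q p → Q q
    Q-step Sign.+ rel Qp = trans (rel (- c)) (trans Qp (cong not (sym (rel c))))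
    Q-step {p} Sign.- rel Qp = trans (rel (- c)) (trans (cong (λ y → does (y ∈? L p)) (neg-involutive c))
      (trans (sym (not-involutive _)) (cong not (trans (sym Qp) (sym (rel c))))))

    Q-all : ∀ x → Q x
    Q-all = propagate G Q conn v (trans (dec-false (- c ∈? L v) -c∉Lv) (cong not (sym (dec-true (c ∈? L v) c∈Lv))))
      λ {_} {_} {s} e∈G → Q-step s (∈?-edge e∈G) , Q-step s (∈?-edge⁻ e∈G)

    flip-edge : ∀ {a b} s → X b ≡ does (act s c ∈? L a) → Q a → X b ≡ flipBy s (X a)
    flip-edge Sign.+ Xb _ = Xb
    flip-edge Sign.- Xb Qa = trans Xb Qa

    balanced : BalancedWith G X
    balanced = All.tabulate λ { {a , b , s} e∈G → crossing X a b s (flip-edge s (∈?-edge e∈G c) (Q-all a)) }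

  symmetric-if-unbalanced : ¬ Balanced G → SymmetricLists G L
  symmetric-if-unbalanced unbalanced = symmetric-lists closed₀ same
    where
    closed₀ : ∀ {c} → c ∈ L v₀ → - c ∈ L v₀
    closed₀ = neg-closed-if-unbalanced unbalanced v₀

    same : ∀ v → SameSet (L v) (L v₀)
    same = propagate G (λ v → SameSet (L v) (L v₀)) conn v₀ (λ _ → ⇔-id _) λ {_} {_} {s} e∈G →
      (λ same-a x → closed s x ⇔-∘ (same-a (act s x) ⇔-∘ edge-⇔ e∈G x)) ,
      (λ same-b x → closed s x ⇔-∘ (same-b (act s x) ⇔-∘ edge-⇔⁻ e∈G x))
      where
      closed : ∀ s x → act s x ∈ L v₀ ⇔ x ∈ L v₀
      closed Sign.+ x = ⇔-id _
      closed Sign.- x = mk⇔ (λ m → subst (_∈ L v₀) (neg-involutive x) (closed₀ m)) closed₀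

-- Sufficiency

module TwistedColouring (G : SGraph) (L : ListAssignment G) (X : Vertex G → Bool) (balanced : BalancedWith G X)
                        {C : List ℤ} (unique-C : Unique C) (|C|≡Δ : length C ≡ Δ G)
                        (on-X : ∀ v → X v ≡ true → SameSet (L v) C)
                        (on-Y : ∀ v → X v ≡ false → SameSet (L v) (neg C)) where

  private
    V = Vertex G

  Lv≈signed : ∀ v → SameSet (L v) (signed (X v) C)
  Lv≈signed v with X v in Xv
  ... | true = on-X v Xv
  ... | false = on-Y v Xv

  large : LargeLists G L
  large = large-if-Δ≤ G L λ v → signed (X v) C , signed-unique (X v) unique-C ,
    ≤-reflexive (trans (sym |C|≡Δ) (sym (length-signed (X v) C))) , λ m → Equivalence.from (Lv≈signed v _) m

  twisted : (V → ℤ) → V → ℤ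
  twisted φ v = act (partSign (X v)) (φ v)

  twisted-∈ : ∀ {φ} → (∀ v → φ v ∈ L v) → ∀ v → twisted φ v ∈ C
  twisted-∈ in-lists v = Equivalence.to (∈-signed (X v)) (Equivalence.to (Lv≈signed v _) (in-lists v))

  twisted-proper : ∀ {φ} → IsColoring G φ → ∀ {a b} → Adjacent G a b → twisted φ a ≢ twisted φ b
  twisted-proper {φ} colouring {a} {b} ((u , w , s) , e∈G , j) with joins⇒ends a b u w {s} j
  ... | inj₁ (refl , refl) = λ eq → All.lookup colouring e∈G
          (act-injective (partSign (X u)) (trans eq (sym (balanced-twist X u w s (All.lookup balanced e∈G) (φ w)))))
  ... | inj₂ (refl , refl) = λ eq → All.lookup colouring e∈G
          (act-injective (partSign (X u)) (trans (sym eq) (sym (balanced-twist X u w s (All.lookup balanced e∈G) (φ w)))))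

  complete-uncolourable : CompleteAdjacency G → Δ G < n G → ¬ LColorable G L
  complete-uncolourable complete Δ<n (φ , colouring , in-lists) = <⇒≱ Δ<n (begin
    n G                                   ≡⟨ length-allFin (n G) ⟨
    length (allFin (n G))                 ≡⟨ length-map (twisted φ) (allFin (n G)) ⟨
    length (map (twisted φ) (allFin _))   ≤⟨ Unique-⊆⇒length-≤ _≟ℤ_ (Unique.map⁺ injective (Unique.allFin⁺ (n G))) ⊆C ⟩
    length C                              ≡⟨ |C|≡Δ ⟩
    Δ G                                   ∎)
    where
    open ≤-Reasoning
    injective : ∀ {a b} → twisted φ a ≡ twisted φ b → a ≡ b
    injective {a} {b} eq with a ≟F b
    ... | yes a≡b = a≡b
    ... | no a≢b = contradiction eq (twisted-proper colouring (complete a b a≢b))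
    ⊆C : map (twisted φ) (allFin (n G)) ⊆ C
    ⊆C m with ∈-map⁻ (twisted φ) m
    ... | v , _ , refl = twisted-∈ in-lists v

  odd-cycle-uncolourable : (walk : ℕ → V) → (∀ k → Adjacent G (walk k) (walk (suc k))) → walk (n G) ≡ walk 0 →
    Odd (n G) → Δ G ≤ 2 → ¬ LColorable G L
  odd-cycle-uncolourable walk adjacent closed odd Δ≤2 (φ , colouring , in-lists) =
    odd-walk-not-2-coloured g odd proper two-valued (cong (twisted φ) closed)
    where
    g : ℕ → ℤ
    g k = twisted φ (walk k)
    proper : ∀ k → g k ≢ g (suc k)
    proper k = twisted-proper colouring (adjacent k)
    two-valued : ∀ k → g k ≡ g 0 ⊎ g k ≡ g 1
    two-valued k with g k ≟ℤ g 0 | g k ≟ℤ g 1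
    ... | yes p | _ = inj₁ p
    ... | no _ | yes q = inj₂ q
    ... | no p | no q = contradiction (≤-trans (three-distinct unique-C (twisted-∈ in-lists _) (twisted-∈ in-lists _)
            (twisted-∈ in-lists _) (proper 0) (p ∘ sym) (q ∘ sym)) (≤-trans (≤-reflexive |C|≡Δ) Δ≤2)) (<⇒≱ ≤-refl)

-- the values f v and the negatives of the nonzero ones are pairwise distinct elements of C
abs-injective⇒length≥ : ∀ {N C} (f : Fin N → ℤ) → (∀ {a b} → ∣ f a ∣ ≡ ∣ f b ∣ → a ≡ b) →
  Unique C → (∀ {x} → x ∈ C → - x ∈ C) → (∀ v → f v ∈ C) → N + pred N ≤ length C
abs-injective⇒length≥ {N} {C} f abs-injective unique-C closed f∈C = begin
  N + pred N         ≤⟨ +-monoʳ-≤ N (pred-mono-≤ (subst (_≤ suc (length Z)) N≡ (+-monoˡ-≤ (length Z) at-most-one-zero))) ⟩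
  N + length Z       ≡⟨ length-D ⟨
  length D           ≤⟨ Unique-⊆⇒length-≤ _≟ℤ_ unique-D D⊆C ⟩
  length C           ∎
  where
  open ≤-Reasoning
  zero? : ∀ v → Dec (f v ≡ + 0)
  zero? v = f v ≟ℤ + 0
  nonzero? : ∀ v → Dec (f v ≢ + 0)
  nonzero? = ¬? ∘ zero?
  zeros Z : List (Fin N)
  zeros = filter zero? (allFin N)
  Z = filter nonzero? (allFin N)
  D : List ℤ
  D = map f (allFin N) ++ map (-_ ∘ f) Z
  unique-D : Unique D
  unique-D = Unique.++⁺ (Unique.map⁺ (abs-injective ∘ cong ∣_∣) (Unique.allFin⁺ N))
    (Unique.map⁺ (abs-injective ∘ cong ∣_∣ ∘ neg-injective) (Unique.filter⁺ nonzero? (Unique.allFin⁺ N)))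
    disjoint
    where
    disjoint : ∀ {x} → ¬ (x ∈ map f (allFin N) × x ∈ map (-_ ∘ f) Z)
    disjoint (m₁ , m₂) with ∈-map⁻ f m₁ | ∈-map⁻ (-_ ∘ f) m₂
    ... | a , _ , refl | b , b∈Z , fa≡-fb with abs-injective {a} {b} (trans (cong ∣_∣ fa≡-fb) (∣-i∣≡∣i∣ (f b)))
    ...   | refl = proj₂ (∈-filter⁻ nonzero? {xs = allFin N} b∈Z) (≡-neg⇒0 fa≡-fb)
  D⊆C : D ⊆ C
  D⊆C m with ∈-++⁻ (map f (allFin N)) m
  ... | inj₁ m₁ with ∈-map⁻ f m₁
  ...   | a , _ , refl = f∈C a
  D⊆C m | inj₂ m₂ with ∈-map⁻ (-_ ∘ f) m₂
  ...   | b , _ , refl = closed (f∈C b)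
  length-D : length D ≡ N + length Z
  length-D = trans (length-++ (map f (allFin N)))
    (cong₂ _+_ (trans (length-map f (allFin N)) (length-allFin N)) (length-map (-_ ∘ f) Z))
  N≡ : length zeros + length Z ≡ N
  N≡ = trans (length-filter-partition zero? (allFin N)) (length-allFin N)
  at-most-one-zero : length zeros ≤ 1
  at-most-one-zero = Unique-constant⇒length≤1 (Unique.filter⁺ zero? (Unique.allFin⁺ N))
    λ m m′ → abs-injective (cong ∣_∣ (trans (zero-value m) (sym (zero-value m′))))
    where
    zero-value : ∀ {v} → v ∈ zeros → f v ≡ + 0
    zero-value = proj₂ ∘ ∈-filter⁻ zero? {xs = allFin N}

module SymmetricListColouring (G : SGraph) (L : ListAssignment G) {C : List ℤ} (unique-C : Unique C)
                              (|C|≡Δ : length C ≡ Δ G) (symmetric : SameSet C (neg C))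
                              (lists : ∀ v → SameSet (L v) C) where

  private
    V = Vertex G

  closed : ∀ {x} → x ∈ C → - x ∈ C
  closed x∈C = ∈-neg⁻ (Equivalence.to (symmetric _) x∈C)

  act-∈C : ∀ s {x} → x ∈ C → act s x ∈ C
  act-∈C Sign.+ x∈C = x∈C
  act-∈C Sign.- x∈C = closed x∈C

  ∈C : ∀ {v x} → x ∈ L v → x ∈ C
  ∈C {v} = Equivalence.to (lists v _)

  large : LargeLists G L
  large = large-if-Δ≤ G L λ v → C , unique-C , ≤-reflexive (sym |C|≡Δ) , Equivalence.from (lists v _)

  along-≢ : ∀ {φ} → IsColoring G φ → ∀ {a b} e → e ∈ edges G → joins a b e ≡ true → φ a ≢ act (proj₂ (proj₂ e)) (φ b)
  along-≢ {φ} colouring {a} {b} (u , w , s) e∈G j with joins⇒ends a b u w {s} j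
  ... | inj₁ (refl , refl) = All.lookup colouring e∈G
  ... | inj₂ (refl , refl) = λ eq → All.lookup colouring e∈G (trans (sym (act-involutive s (φ u))) (cong (act s) (sym eq)))

  abs-proper : ∀ {φ} → IsColoring G φ → BothSigns G → ∀ {a b} → Adjacent G a b → ∣ φ a ∣ ≢ ∣ φ b ∣
  abs-proper {φ} colouring both {a} {b} adj eq with both adj Sign.+ | both adj Sign.- | ∣∣-injective± (φ a) (φ b) eq
  ... | e , e∈G , j , refl | _ | inj₁ φa≡φb = along-≢ colouring e e∈G j φa≡φb
  ... | _ | e , e∈G , j , refl | inj₂ φa≡-φb = along-≢ colouring e e∈G j φa≡-φb

  doubled-complete-uncolourable : 2 ≤ n G → CompleteAdjacency G → BothSigns G →
    Δ G ≤ pred (n G) * 2 → ¬ LColorable G L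
  doubled-complete-uncolourable 2≤n complete both Δ≤ (φ , colouring , in-lists) = too-many 2≤n
    (≤-trans (abs-injective⇒length≥ φ abs-injective unique-C closed (∈C ∘ in-lists)) (≤-trans (≤-reflexive |C|≡Δ) Δ≤))
    where
    abs-injective : ∀ {a b} → ∣ φ a ∣ ≡ ∣ φ b ∣ → a ≡ b
    abs-injective {a} {b} eq with a ≟F b
    ... | yes a≡b = a≡b
    ... | no a≢b = contradiction eq (abs-proper colouring both (complete a b a≢b))
    too-many : ∀ {N} → 2 ≤ N → N + pred N ≤ pred N * 2 → ⊥
    too-many {suc m} _ le = 1+n≰n (≤-trans le (≤-reflexive (trans (*-comm m 2) (cong (λ k → m + k) (+-identityʳ m)))))

  doubled-odd-cycle-uncolourable : (walk : ℕ → V) → (∀ k → Adjacent G (walk k) (walk (suc k))) →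
    walk (n G) ≡ walk 0 → Odd (n G) → BothSigns G → Δ G ≤ 4 → ¬ LColorable G L
  doubled-odd-cycle-uncolourable walk adjacent closed-walk odd both Δ≤4 (φ , colouring , in-lists) =
    by-third-value (any? λ v → ¬? (∣ φ v ∣ ℕ.≟ g 0) ×-dec ¬? (∣ φ v ∣ ℕ.≟ g 1))
    where
    g : ℕ → ℕ
    g k = ∣ φ (walk k) ∣
    proper : ∀ k → g k ≢ g (suc k)
    proper k = abs-proper colouring both (adjacent k)
    by-third-value : Dec (∃[ v ] (∣ φ v ∣ ≢ g 0 × ∣ φ v ∣ ≢ g 1)) → ⊥
    by-third-value (yes (v , v≢₀ , v≢₁)) = contradiction (≤-trans (three-absolute-values unique-C closed
      (∈C (in-lists (walk 0))) (∈C (in-lists (walk 1))) (∈C (in-lists v)) (proper 0) (v≢₀ ∘ sym) (v≢₁ ∘ sym))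
      (≤-trans (≤-reflexive |C|≡Δ) Δ≤4)) (<⇒≱ ≤-refl)
    by-third-value (no two-values) = odd-walk-not-2-coloured g odd proper two-valued (cong (λ v → ∣ φ v ∣) closed-walk)
      where
      two-valued : ∀ k → g k ≡ g 0 ⊎ g k ≡ g 1
      two-valued k with g k ℕ.≟ g 0 | g k ℕ.≟ g 1
      ... | yes p | _ = inj₁ p
      ... | no _ | yes q = inj₂ q
      ... | no p | no q = contradiction (walk k , p , q) two-values

  module _ (|C|≤2 : length C ≤ 2) where

    private
      not-three : ∀ {x y z} → x ∈ C → y ∈ C → z ∈ C → x ≢ y → x ≢ z → y ≢ z → ⊥
      not-three x∈C y∈C z∈C x≢y x≢z y≢z = contradiction (≤-trans (three-distinct unique-C x∈C y∈C z∈C x≢y x≢z y≢z) |C|≤2) (<⇒≱ ≤-refl)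

    ±-only : ∀ {x y} → x ∈ C → y ∈ C → y ≢ + 0 → x ≡ y ⊎ x ≡ - y
    ±-only {x} {y} x∈C y∈C y≢0 with x ≟ℤ y | x ≟ℤ - y
    ... | yes x≡y | _ = inj₁ x≡y
    ... | no _ | yes x≡-y = inj₂ x≡-y
    ... | no x≢y | no x≢-y = ⊥-elim (not-three y∈C (closed y∈C) x∈C (≢0⇒≢-neg y≢0) (x≢y ∘ sym) (x≢-y ∘ sym))

    edge-colours : ∀ {x y} s → x ∈ C → y ∈ C → x ≢ act s y → y ≢ + 0 × x ≡ - act s y
    edge-colours {x} {y} s x∈C y∈C x≢sy = y≢0 , opposite
      where
      y≢0 : y ≢ + 0
      y≢0 refl = not-three (closed x∈C) x∈C y∈C (≢0⇒≢-neg x≢0 ∘ sym)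
        (λ eq → x≢0 (trans (sym (neg-involutive x)) (cong -_ eq))) x≢0
        where
        x≢0 : x ≢ + 0
        x≢0 x≡0 = x≢sy (trans x≡0 (sym (act-0 s)))
      opposite : x ≡ - act s y
      opposite with ±-only x∈C (act-∈C s y∈C) (y≢0 ∘ act-injective s ∘ flip trans (sym (act-0 s)))
      ... | inj₁ x≡sy = contradiction x≡sy x≢sy
      ... | inj₂ x≡-sy = x≡-sy

    -- a colouring from C makes any 2-colourable graph balanced
    bipartite-uncolourable : (side : V → Bool) → (∀ {a b s} → (a , b , s) ∈ edges G → side b ≡ not (side a)) →
      V → ¬ Balanced G → ¬ LColorable G L
    bipartite-uncolourable side alternates v₀ unbalanced (φ , colouring , in-lists) = unbalanced (X , balanced)
      where
      x₀ : ℤ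
      x₀ = φ v₀
      is-x₀ : V → Bool
      is-x₀ v = does (φ v ≟ℤ x₀)
      X : V → Bool
      X v = is-x₀ v xor side v

      -- as |C| ≤ 2, one of ± φ b is x₀
      is-x₀-neg : ∀ {a b} → φ b ≢ + 0 → φ a ≡ - φ b → is-x₀ a ≡ not (is-x₀ b)
      is-x₀-neg {a} {b} φb≢0 φa≡-φb with ±-only (∈C (in-lists v₀)) (∈C (in-lists b)) φb≢0
      ... | inj₁ x₀≡φb = trans (dec-false (φ a ≟ℤ x₀) λ φa≡x₀ → ≢0⇒≢-neg φb≢0 (trans (sym x₀≡φb) (trans (sym φa≡x₀) φa≡-φb)))
                           (cong not (sym (dec-true (φ b ≟ℤ x₀) (sym x₀≡φb))))
      ... | inj₂ x₀≡-φb = trans (dec-true (φ a ≟ℤ x₀) (trans φa≡-φb (sym x₀≡-φb)))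
                            (cong not (sym (dec-false (φ b ≟ℤ x₀) λ eq → ≢0⇒≢-neg φb≢0 (trans eq x₀≡-φb))))

      flips : ∀ {a b} s → (a , b , s) ∈ edges G → X b ≡ flipBy s (X a)
      flips {a} {b} s e∈G with edge-colours s (∈C (in-lists a)) (∈C (in-lists b)) (All.lookup colouring e∈G)
      flips {a} {b} Sign.+ e∈G | φb≢0 , φa≡-φb = begin
        is-x₀ b xor side b              ≡⟨ cong₂ _xor_ (trans (sym (not-involutive _)) (cong not (sym (is-x₀-neg φb≢0 φa≡-φb)))) (alternates e∈G) ⟩
        not (is-x₀ a) xor not (side a)  ≡⟨ not-distribˡ-xor (is-x₀ a) (not (side a)) ⟨
        not (is-x₀ a xor not (side a))  ≡⟨ cong not (not-distribʳ-xor (is-x₀ a) (side a)) ⟨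
        not (not (is-x₀ a xor side a))  ≡⟨ not-involutive _ ⟩
        X a                             ∎
        where open ≡-Reasoning
      flips {a} {b} Sign.- e∈G | _ , φa≡φb = begin
        is-x₀ b xor side b              ≡⟨ cong₂ _xor_ (cong (λ x → does (x ≟ℤ x₀)) (trans (sym (neg-involutive (φ b))) (sym φa≡φb))) (alternates e∈G) ⟩
        is-x₀ a xor not (side a)        ≡⟨ not-distribʳ-xor (is-x₀ a) (side a) ⟨
        not (X a)                       ∎
        where open ≡-Reasoning

      balanced : BalancedWith G X
      balanced = All.tabulate λ { {a , b , s} e∈G → crossing X a b s (flips s e∈G) }

-- Orderings and walks of complete graphs and cycles

complete-leads : ∀ G → CompleteAdjacency G → ∀ {w} vs → Unique vs → All (_≢ w) vs → LeadsTo G vs w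
complete-leads G complete [] _ _ = tt
complete-leads G complete (v ∷ vs) (v∉vs ∷ unique) (v≢w ∷ vs≢w) =
  complete v _ (headOr-All v∉vs v≢w) , complete-leads G complete vs unique vs≢w

complete-orderings : ∀ G → CompleteAdjacency G → EdgeOrderings G
complete-orderings G complete {u} {w} _ = record
  { order = others
  ; unique = unique
  ; avoids-first = All.tabulate (proj₁ ∘ outside)
  ; avoids-last = λ w∈ → proj₂ (outside w∈) refl
  ; leads = complete-leads G complete others unique (All.tabulate (proj₂ ∘ outside))
  ; covers = covers
  }
  where
  other? : ∀ x → Dec (x ≢ u × x ≢ w)
  other? x = ¬? (x ≟F u) ×-dec ¬? (x ≟F w)
  others : List (Vertex G)
  others = filter other? (allFin (n G))
  unique : Unique others
  unique = Unique.filter⁺ other? (Unique.allFin⁺ (n G))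
  outside : ∀ {x} → x ∈ others → x ≢ u × x ≢ w
  outside = proj₂ ∘ ∈-filter⁻ other? {xs = allFin (n G)}
  covers : ∀ x → x ≢ w → x ≡ u ⊎ x ∈ others
  covers x x≢w with x ≟F u
  ... | yes x≡u = inj₁ x≡u
  ... | no x≢u = inj₂ (∈-filter⁺ other? (∈-allFin x) (x≢u , x≢w))

module Cyclic (N : ℕ) (2≤N : 2 ≤ N) where
  instance
    N-nonZero : NonZero N
    N-nonZero = >-nonZero (≤-trans (s≤s z≤n) 2≤N)

  nxt-cases : ∀ r → r < N → (suc r ≡ N × nxt N r ≡ 0) ⊎ (suc r < N × nxt N r ≡ suc r)
  nxt-cases r r<N with suc r ℕ.≡ᵇ N in eq
  ... | true = inj₁ (≡ᵇ-true⁻ eq , refl)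
  ... | false = inj₂ (≤∧≢⇒< r<N (λ 1+r≡N → contradiction (trans (sym (≡ᵇ-true 1+r≡N)) eq) λ ()) , refl)

  private
    suc-%-% : ∀ k → suc k % N ≡ suc (k % N) % N
    suc-%-% k = trans (%-distribˡ-+ 1 k N) (cong (λ z → (z + k % N) % N) (m<n⇒m%n≡m 2≤N))

  suc-% : ∀ k → suc k % N ≡ nxt N (k % N)
  suc-% k with nxt-cases (k % N) (m%n<n k N)
  ... | inj₁ (1+r≡N , nxt≡0) = trans (suc-%-% k) (trans (cong (_% N) 1+r≡N) (trans (n%n≡0 N) (sym nxt≡0)))
  ... | inj₂ (1+r<N , nxt≡1+r) = trans (suc-%-% k) (trans (m<n⇒m%n≡m 1+r<N) (sym nxt≡1+r))

  nxt-injective : ∀ {x y} → x < N → y < N → nxt N x ≡ nxt N y → x ≡ y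
  nxt-injective {x} {y} x<N y<N eq with nxt-cases x x<N | nxt-cases y y<N
  ... | inj₁ (p , _) | inj₁ (q , _) = suc-injective (trans p (sym q))
  ... | inj₁ (_ , p) | inj₂ (_ , q) with () ← trans (sym p) (trans eq q)
  ... | inj₂ (_ , p) | inj₁ (_ , q) with () ← trans (sym q) (trans (sym eq) p)
  ... | inj₂ (_ , p) | inj₂ (_ , q) = suc-injective (trans (sym p) (trans eq q))

  private
    shift-fixes⇒0 : ∀ {r d} → r < N → d < N → (r + d) % N ≡ r → d ≡ 0
    shift-fixes⇒0 {r} {d} r<N d<N eq with r + d <? N
    ... | yes r+d<N = +-cancelˡ-≡ r d 0 (trans (trans (sym (m<n⇒m%n≡m r+d<N)) eq) (sym (+-identityʳ r)))
    ... | no r+d≮N = contradiction (+-cancelˡ-≡ r d N (begin-equality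
        r + d            ≡⟨ m∸n+n≡m N≤r+d ⟨
        r + d ∸ N + N    ≡⟨ cong (_+ N) wrapped ⟩
        r + N            ∎)) (<⇒≢ d<N)
      where
      open ≤-Reasoning
      N≤r+d : N ≤ r + d
      N≤r+d = ≮⇒≥ r+d≮N
      wrapped : r + d ∸ N ≡ r
      wrapped = trans (sym (m<n⇒m%n≡m (+-cancelʳ-< N _ N (subst (_< N + N) (sym (m∸n+n≡m N≤r+d)) (+-mono-< r<N d<N)))))
                      (trans (m≤n⇒[n∸m]%m≡n%m N≤r+d) eq)

    +-%-injective-≤ : ∀ B {t t′} → t ≤ t′ → t′ < N → (B + t) % N ≡ (B + t′) % N → t ≡ t′
    +-%-injective-≤ B {t} {t′} t≤t′ t′<N eq = sym (trans (sym (m+[n∸m]≡n t≤t′)) (trans (cong (λ k → t + k) d≡0) (+-identityʳ t)))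
      where
      open ≤-Reasoning
      d<N : t′ ∸ t < N
      d<N = ≤-<-trans (m∸n≤m t′ t) t′<N
      d≡0 : t′ ∸ t ≡ 0
      d≡0 = shift-fixes⇒0 (m%n<n (B + t) N) d<N (begin-equality
        ((B + t) % N + (t′ ∸ t)) % N        ≡⟨ cong (λ z → ((B + t) % N + z) % N) (m<n⇒m%n≡m d<N) ⟨
        ((B + t) % N + (t′ ∸ t) % N) % N    ≡⟨ %-distribˡ-+ (B + t) (t′ ∸ t) N ⟨
        (B + t + (t′ ∸ t)) % N              ≡⟨ cong (_% N) (trans (+-assoc B t _) (cong (λ k → B + k) (m+[n∸m]≡n t≤t′))) ⟩
        (B + t′) % N                        ≡⟨ eq ⟨
        (B + t) % N                         ∎)

  +-%-injective : ∀ B {t t′} → t < N → t′ < N → (B + t) % N ≡ (B + t′) % N → t ≡ t′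
  +-%-injective B t<N t′<N eq with ≤-total _ _
  ... | inj₁ t≤t′ = +-%-injective-≤ B t≤t′ t′<N eq
  ... | inj₂ t′≤t = sym (+-%-injective-≤ B t′≤t t<N (sym eq))

  Consecutive : Fin N → Fin N → Set
  Consecutive i j = toℕ j ≡ nxt N (toℕ i)

  nxt-nxt-≢ : 3 ≤ N → ∀ {r} → r < N → nxt N (nxt N r) ≢ r
  nxt-nxt-≢ 3≤N {r} r<N eq with nxt-cases r r<N
  ... | inj₁ (1+r≡N , nxt[r]≡0) with nxt-cases 0 (≤-trans (s≤s z≤n) 2≤N)
  ...   | inj₁ (1≡N , _) = <⇒≢ (≤-trans (s≤s (s≤s z≤n)) 3≤N) 1≡N
  ...   | inj₂ (_ , nxt[0]≡1) = <⇒≢ 3≤N (trans (cong suc (trans (sym nxt[0]≡1) (trans (cong (nxt N) (sym nxt[r]≡0)) eq))) 1+r≡N)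
  nxt-nxt-≢ 3≤N {r} r<N eq | inj₂ (1+r<N , nxt[r]≡1+r) with nxt-cases (suc r) 1+r<N
  ...   | inj₁ (2+r≡N , nxt[1+r]≡0) =
    <⇒≢ 3≤N (trans (cong (λ z → 2 + z) (trans (sym nxt[1+r]≡0) (trans (cong (nxt N) (sym nxt[r]≡1+r)) eq))) 2+r≡N)
  ...   | inj₂ (_ , nxt[1+r]≡2+r) =
    <⇒≢ (≤-trans (n<1+n r) (n≤1+n (suc r))) (sym (trans (sym nxt[1+r]≡2+r) (trans (cong (nxt N) (sym nxt[r]≡1+r)) eq)))

  private
    cycStep : Fin N → Fin N → ℕ → Bool
    cycStep i j k = ((toℕ i ℕ.≡ᵇ k) ∧ (toℕ j ℕ.≡ᵇ nxt N k)) ∨ ((toℕ j ℕ.≡ᵇ k) ∧ (toℕ i ℕ.≡ᵇ nxt N k))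


    cycStep⁻ : ∀ {i j k} → cycStep i j k ≡ true →
      (toℕ i ≡ k × toℕ j ≡ nxt N k) ⊎ (toℕ j ≡ k × toℕ i ≡ nxt N k)
    cycStep⁻ {i} {j} {k} h with ∨-true⁻ ((toℕ i ℕ.≡ᵇ k) ∧ (toℕ j ℕ.≡ᵇ nxt N k)) h
    ... | inj₁ h₁ = let p , q = ∧-true⁻ _ h₁ in inj₁ (≡ᵇ-true⁻ p , ≡ᵇ-true⁻ q)
    ... | inj₂ h₂ = let p , q = ∧-true⁻ _ h₂ in inj₂ (≡ᵇ-true⁻ p , ≡ᵇ-true⁻ q)

    counted⁻ : ∀ {i j k} → k ∈ filterᵇ (cycStep i j) (upTo N) →
      (toℕ i ≡ k × toℕ j ≡ nxt N k) ⊎ (toℕ j ≡ k × toℕ i ≡ nxt N k)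
    counted⁻ {i} {j} k∈ = cycStep⁻ (Equivalence.to T-≡ (proj₂ (∈-filter⁻ (T? ∘ cycStep i j) {xs = upTo N} k∈)))

    cycMult-≤ : ∀ i j ks → (∀ {k} → k ∈ filterᵇ (cycStep i j) (upTo N) → k ∈ ks) → cycMult N i j ≤ length ks
    cycMult-≤ i j ks ⊆ks = Unique-⊆⇒length-≤ ℕ._≟_ (Unique.filter⁺ (T? ∘ cycStep i j) (Unique.upTo⁺ N)) ⊆ks

  consecutive⇒cycMult≥1 : ∀ i j → Consecutive i j → 1 ≤ cycMult N i j
  consecutive⇒cycMult≥1 i j j≡nxt[i] = count-≥1 (cycStep i j) (∈-upTo⁺ (toℕ<n i)) i-counted
    where
    i-counted : cycStep i j (toℕ i) ≡ true
    i-counted rewrite ≡ᵇ-true {toℕ i} refl | ≡ᵇ-true j≡nxt[i] = refl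

  cycMult≥1⇒consecutive : ∀ i j → 1 ≤ cycMult N i j → Consecutive i j ⊎ Consecutive j i
  cycMult≥1⇒consecutive i j h with count-≥1⁻ (cycStep i j) (upTo N) h
  ... | k , _ , k-counted with cycStep⁻ {i} {j} k-counted
  ...   | inj₁ (refl , j≡nxt) = inj₁ j≡nxt
  ...   | inj₂ (refl , i≡nxt) = inj₂ i≡nxt

  cycMult≤2 : ∀ i j → cycMult N i j ≤ 2
  cycMult≤2 i j = cycMult-≤ i j (toℕ i ∷ toℕ j ∷ []) λ k∈ → case counted⁻ {i} {j} k∈ of λ
    { (inj₁ (refl , _)) → here refl ; (inj₂ (refl , _)) → there (here refl) }

  cycMult≤1 : 3 ≤ N → ∀ i j → cycMult N i j ≤ 1
  cycMult≤1 3≤N i j with toℕ j ℕ.≟ nxt N (toℕ i)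
  ... | yes j≡nxt = cycMult-≤ i j (toℕ i ∷ []) λ k∈ → case counted⁻ {i} {j} k∈ of λ
    { (inj₁ (refl , _)) → here refl
    ; (inj₂ (refl , i≡nxt)) → contradiction (trans (cong (nxt N) (sym j≡nxt)) (sym i≡nxt)) (nxt-nxt-≢ 3≤N (toℕ<n i)) }
  ... | no j≢nxt = cycMult-≤ i j (toℕ j ∷ []) λ k∈ → case counted⁻ {i} {j} k∈ of λ
    { (inj₁ (refl , j≡nxt)) → contradiction j≡nxt j≢nxt ; (inj₂ (refl , _)) → here refl }

module CycleWalk (G : SGraph) (2≤n : 2 ≤ n G) (π : Vertex G → Vertex G) (π-injective : ∀ {x y} → π x ≡ π y → x ≡ y)
                 (adjacent⇔ : ∀ i j → Adjacent G (π i) (π j) ⇔ 1 ≤ cycMult (n G) i j) where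

  private
    N = n G
    V = Vertex G

  open Cyclic N 2≤n public

  π-surjective : ∀ v → ∃[ i ] (π i ≡ v)
  π-surjective = injective⇒surjective π π-injective

  adjacent⇒consecutive : ∀ i j → Adjacent G (π i) (π j) → Consecutive i j ⊎ Consecutive j i
  adjacent⇒consecutive i j = cycMult≥1⇒consecutive i j ∘ Equivalence.to (adjacent⇔ i j)

  position : ℕ → Fin N
  position k = fromℕ< (m%n<n k N)

  walk : ℕ → V
  walk k = π (position k)

  private
    toℕ-position : ∀ k → toℕ (position k) ≡ k % N
    toℕ-position k = toℕ-fromℕ< (m%n<n k N)

    walk-at : ∀ {k} {i : Fin N} → k % N ≡ toℕ i → walk k ≡ π i
    walk-at {k} eq = cong π (toℕ-injective (trans (toℕ-position k) eq))

  walk-toℕ : ∀ i → walk (toℕ i) ≡ π i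
  walk-toℕ i = walk-at (m<n⇒m%n≡m (toℕ<n i))

  walk-+N : ∀ k → walk (k + N) ≡ walk k
  walk-+N k = walk-at (trans ([m+n]%n≡m%n k N) (sym (toℕ-position k)))

  walk-next : ∀ i j → Consecutive i j → walk (suc (toℕ i)) ≡ π j
  walk-next i j j≡nxt = walk-at (trans (suc-% (toℕ i)) (trans (cong (nxt N) (m<n⇒m%n≡m (toℕ<n i))) (sym j≡nxt)))

  walk-adjacent : ∀ k → Adjacent G (walk k) (walk (suc k))
  walk-adjacent k = Equivalence.from (adjacent⇔ _ _) (consecutive⇒cycMult≥1 _ _
    (trans (toℕ-position (suc k)) (trans (suc-% k) (cong (nxt N) (sym (toℕ-position k))))))

  walk-injective : ∀ B {t t′} → t < N → t′ < N → walk (B + t) ≡ walk (B + t′) → t ≡ t′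
  walk-injective B t<N t′<N eq =
    +-%-injective B t<N t′<N (trans (sym (toℕ-position _)) (trans (cong toℕ (π-injective eq)) (toℕ-position _)))

  walk-covers : ∀ B v → ∃[ t ] (t < N × walk (B + t) ≡ v)
  walk-covers B v with injective⇒surjective (λ t → walk (B + toℕ t))
                         (λ eq → toℕ-injective (walk-injective B (toℕ<n _) (toℕ<n _) eq)) v
  ... | t , eq = toℕ t , toℕ<n t , eq

  connected : Connected G
  connected = connected-from G (walk 0) λ v → let t , _ , eq = walk-covers 0 v in subst (Reach G (walk 0)) eq (reach t)
    where
    reach : ∀ k → Reach G (walk 0) (walk k)
    reach zero = here
    reach (suc k) = step (reach k) (walk-adjacent k)

  private
    -- f 0 = u and f 1 = w; the other vertices are listed as f (N-1), …, f 2, each adjacent to the next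
    ordering-from : (f : ℕ → V) → (∀ t → suc t < N → Adjacent G (f (suc t)) (f t)) →
      (∀ {t t′} → t < N → t′ < N → f t ≡ f t′ → t ≡ t′) → (∀ v → ∃[ t ] (t < N × f t ≡ v)) → Ordering G (f 0) (f 1)
    ordering-from f adjacent f-injective f-covers = record
      { order = applyDownFrom g (N ∸ 2)
      ; unique = Unique.applyDownFrom⁺₁ g (N ∸ 2) λ j<i i<N∸2 eq →
          <⇒≢ j<i (sym (+-cancelˡ-≡ 2 _ _ (f-injective (in-range i<N∸2) (in-range (<-trans j<i i<N∸2)) eq)))
      ; avoids-first = All.tabulate λ m eq → let t , t< , v≡ = ∈-applyDownFrom⁻ g m in
          0≢1+n (f-injective (≤-trans (s≤s z≤n) 2≤n) (in-range t<) (trans (sym eq) v≡))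
      ; avoids-last = λ m → let t , t< , w≡ = ∈-applyDownFrom⁻ g m in 0≢1+n (suc-injective (f-injective 2≤n (in-range t<) w≡))
      ; leads = leads (N ∸ 2) ≤-refl
      ; covers = covers
      }
      where
      g : ℕ → V
      g t = f (2 + t)
      in-range : ∀ {t} → t < N ∸ 2 → 2 + t < N
      in-range {t} t< = subst (2 + t <_) (m+[n∸m]≡n 2≤n) (+-monoʳ-< 2 t<)
      leads : ∀ m → m ≤ N ∸ 2 → LeadsTo G (applyDownFrom g m) (f 1)
      leads zero _ = tt
      leads (suc zero) m≤ = adjacent 1 (in-range m≤) , tt
      leads (suc (suc m)) m≤ = adjacent (2 + m) (in-range m≤) , leads (suc m) (≤-trans (n≤1+n _) m≤)
      covers : ∀ v → v ≢ f 1 → v ≡ f 0 ⊎ v ∈ applyDownFrom g (N ∸ 2)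
      covers v v≢w with f-covers v
      ... | zero , _ , f0≡v = inj₁ (sym f0≡v)
      ... | suc zero , _ , f1≡v = contradiction (sym f1≡v) v≢w
      ... | suc (suc t) , 2+t<N , ft≡v =
        inj₂ (subst (_∈ _) ft≡v (∈-applyDownFrom⁺ g (s≤s⁻¹ (s≤s⁻¹ (subst (2 + t <_) (sym (m+[n∸m]≡n 2≤n)) 2+t<N)))))

    1+[N∸1+s]≡N∸s : ∀ {s} → s < N → suc (N ∸ suc s) ≡ N ∸ s
    1+[N∸1+s]≡N∸s s<N = sym (+-∸-assoc 1 s<N)

    N∸1+s<N : ∀ s → N ∸ suc s < N
    N∸1+s<N s = ≤-<-trans (∸-monoʳ-≤ N (s≤s z≤n)) (∸-monoʳ-< (s≤s z≤n) (≤-trans (s≤s z≤n) 2≤n))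

  private
    ordering-forward : ∀ i j → Consecutive i j → Ordering G (π i) (π j)
    ordering-forward i j j≡nxt = subst₂ (Ordering G) f0 f1 (ordering-from f
        (λ t _ → subst (λ x → Adjacent G x (f t)) (cong walk (sym (+-suc I t))) (adjacent-sym G (walk-adjacent (I + t))))
        (walk-injective I) (walk-covers I))
      where
      I : ℕ
      I = toℕ i
      f : ℕ → V
      f t = walk (I + t)
      f0 : f 0 ≡ π i
      f0 = trans (cong walk (+-identityʳ I)) (walk-toℕ i)
      f1 : f 1 ≡ π j
      f1 = trans (cong walk (+-comm I 1)) (walk-next i j j≡nxt)

    ordering-backward : ∀ i j → Consecutive j i → Ordering G (π i) (π j)
    ordering-backward i j i≡nxt = subst₂ (Ordering G) f0 f1 (ordering-from f adjacent-f injective-f covers-f)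
      where
      J B : ℕ
      J = toℕ j
      B = J + 2
      f : ℕ → V
      f t = walk (B + (N ∸ suc t))
      f0 : f 0 ≡ π i
      f0 = trans (cong walk (begin-equality
        J + 2 + (N ∸ 1)       ≡⟨ +-assoc J 2 (N ∸ 1) ⟩
        J + suc (suc (N ∸ 1)) ≡⟨ cong (λ k → J + suc k) (1+[N∸1+s]≡N∸s (≤-trans (s≤s z≤n) 2≤n)) ⟩
        J + suc N             ≡⟨ +-suc J N ⟩
        suc J + N             ∎)) (trans (walk-+N (suc J)) (walk-next j i i≡nxt))
        where open ≤-Reasoning
      f1 : f 1 ≡ π j
      f1 = trans (cong walk (trans (+-assoc J 2 (N ∸ 2)) (cong (λ k → J + k) (m+[n∸m]≡n 2≤n)))) (trans (walk-+N J) (walk-toℕ j))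
      adjacent-f : ∀ t → suc t < N → Adjacent G (f (suc t)) (f t)
      adjacent-f t 1+t<N = subst (Adjacent G (f (suc t)))
        (cong walk (trans (sym (+-suc B _)) (cong (λ k → B + k) (1+[N∸1+s]≡N∸s 1+t<N)))) (walk-adjacent _)
      injective-f : ∀ {t t′} → t < N → t′ < N → f t ≡ f t′ → t ≡ t′
      injective-f {t} {t′} t<N t′<N eq = suc-injective (∸-cancelˡ-≡ t<N t′<N (walk-injective B (N∸1+s<N t) (N∸1+s<N t′) eq))
      covers-f : ∀ v → ∃[ t ] (t < N × f t ≡ v)
      covers-f v with walk-covers B v
      ... | s , s<N , eq = N ∸ suc s , N∸1+s<N s ,
        trans (cong (λ k → walk (B + k)) (trans (cong (N ∸_) (1+[N∸1+s]≡N∸s s<N)) (m∸[m∸n]≡n (<⇒≤ s<N)))) eq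

  orderings : EdgeOrderings G
  orderings {u} {w} adj with π-surjective u | π-surjective w
  ... | i , refl | j , refl with adjacent⇒consecutive i j adj
  ... | inj₁ j≡nxt = ordering-forward i j j≡nxt
  ... | inj₂ i≡nxt = ordering-backward i j i≡nxt

  index : V → Fin N
  index v = proj₁ (π-surjective v)

  π-index : ∀ v → π (index v) ≡ v
  π-index v = proj₂ (π-surjective v)

  walk-neighbour : ∀ i {x} → Adjacent G (π i) x → x ≡ walk (suc (toℕ i)) ⊎ x ≡ walk (toℕ i + pred N)
  walk-neighbour i {x} adj with π-surjective x
  ... | j , refl with adjacent⇒consecutive i j adj
  ...   | inj₁ j≡nxt = inj₁ (sym (walk-next i j j≡nxt))
  ...   | inj₂ i≡nxt = inj₂ (sym (walk-at (sym (nxt-injective (toℕ<n j) (m%n<n _ N) (begin-equality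
    nxt N (toℕ j)                       ≡⟨ i≡nxt ⟨
    toℕ i                               ≡⟨ m<n⇒m%n≡m (toℕ<n i) ⟨
    toℕ i % N                           ≡⟨ [m+n]%n≡m%n (toℕ i) N ⟨
    (toℕ i + N) % N                     ≡⟨ cong (λ k → (toℕ i + k) % N) (suc-pred N) ⟨
    (toℕ i + suc (pred N)) % N          ≡⟨ cong (_% N) (+-suc (toℕ i) (pred N)) ⟩
    suc (toℕ i + pred N) % N            ≡⟨ suc-% (toℕ i + pred N) ⟩
    nxt N ((toℕ i + pred N) % N)        ∎)))))
    where open ≤-Reasoning

  edge-neighbour : ∀ v {e} → e ∈ edges G → hasEnd v e ≡ true → ∃[ w ] (Adjacent G v w × joins v w e ≡ true)
  edge-neighbour v {a , b , s} e∈G at-v with hasEnd⇒end v a b {s} at-v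
  ... | inj₁ refl = b , edge⇒adjacent G e∈G , joins-self a b s
  ... | inj₂ refl = a , adjacent-sym G (edge⇒adjacent G e∈G) , joins-swap a b s

  private
    around : ∀ v {e} → e ∈ edges G → hasEnd v e ≡ true →
      ∃[ w ] ((w ≡ walk (suc (toℕ (index v))) ⊎ w ≡ walk (toℕ (index v) + pred N)) × joins v w e ≡ true)
    around v e∈G at-v with edge-neighbour v e∈G at-v
    ... | w , adj , j = w , walk-neighbour (index v) (subst (λ x → Adjacent G x w) (sym (π-index v)) adj) , j

  deg≤2* : ∀ {c} → (∀ a b → mult G a b ≤ c) → ∀ v → deg G v ≤ 2 * c
  deg≤2* {c} mult≤c v = ≤-trans (deg≤sum-mult G v (_ ∷ _ ∷ []) covered) (+-mono-≤ (mult≤c v _) (+-mono-≤ (mult≤c v _) z≤n))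
    where
    covered : ∀ {e} → e ∈ edges G → hasEnd v e ≡ true → _
    covered e∈G at-v with around v e∈G at-v
    ... | w , inj₁ refl , j = w , here refl , j
    ... | w , inj₂ refl , j = w , there (here refl) , j

  -- on two vertices the next and the previous vertex coincide
  deg≤-if-N≡2 : N ≡ 2 → ∀ {c} → (∀ a b → mult G a b ≤ c) → ∀ v → deg G v ≤ c
  deg≤-if-N≡2 N≡2 {c} mult≤c v = ≤-trans (deg≤sum-mult G v (_ ∷ []) covered) (≤-trans (+-mono-≤ (mult≤c v _) z≤n) (≤-reflexive (+-identityʳ c)))
    where
    covered : ∀ {e} → e ∈ edges G → hasEnd v e ≡ true → _
    covered e∈G at-v with around v e∈G at-v
    ... | w , inj₁ refl , j = w , here refl , j
    ... | w , inj₂ refl , j = w , here (cong walk (trans (cong (λ k → toℕ (index v) + pred k) N≡2) (+-comm (toℕ (index v)) 1))) , j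

  module _ (even : Even N) where

    isEven-nxt : ∀ {r} → r < N → isEven (nxt N r) ≡ not (isEven r)
    isEven-nxt {r} r<N with nxt-cases r r<N
    ... | inj₁ (1+r≡N , nxt≡0) rewrite nxt≡0 = sym (trans (cong isEven 1+r≡N) (isEven-even even))
    ... | inj₂ (_ , nxt≡1+r) rewrite nxt≡1+r = refl

    side : V → Bool
    side v = isEven (toℕ (index v))

    side-alternates : ∀ {a b s} → (a , b , s) ∈ edges G → side b ≡ not (side a)
    side-alternates {a} {b} e∈G with adjacent⇒consecutive (index a) (index b)
      (subst₂ (Adjacent G) (sym (π-index a)) (sym (π-index b)) (edge⇒adjacent G e∈G))
    ... | inj₁ b≡nxt = trans (cong isEven b≡nxt) (isEven-nxt (toℕ<n (index a)))
    ... | inj₂ a≡nxt = trans (sym (not-involutive _)) (cong not (sym (trans (cong isEven a≡nxt) (isEven-nxt (toℕ<n (index b))))))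

cycle-adjacent⇔ : ∀ G (cycle : IsCycle G) → let π = proj₁ (proj₂ cycle) in
  ∀ i j → Adjacent G (π i) (π j) ⇔ 1 ≤ cycMult (n G) i j
cycle-adjacent⇔ G (_ , π , _ , mult≡) i j = mk⇔
  (λ adj → subst (1 ≤_) (mult≡ i j) (adjacent⇒mult≥1 G adj))
  (λ cyc≥1 → mult≥1⇒adjacent G (subst (1 ≤_) (sym (mult≡ i j)) cyc≥1))

doubled-cycle-adjacent⇔ : ∀ G (cycle : Is2C G) → let π = proj₁ (proj₂ cycle) in
  ∀ i j → Adjacent G (π i) (π j) ⇔ 1 ≤ cycMult (n G) i j
doubled-cycle-adjacent⇔ G (_ , π , _ , mult≡) i j = mk⇔
  (λ adj → 1≤m+m⇒1≤m (subst (1 ≤_) mult≡2cyc (adjacent⇒mult≥1 G adj)))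
  (λ cyc≥1 → mult≥1⇒adjacent G (subst (1 ≤_) (sym mult≡2cyc) (≤-trans cyc≥1 (m≤m+n _ _))))
  where
  mult≡2cyc : mult G (π i) (π j) ≡ cycMult (n G) i j + cycMult (n G) i j
  mult≡2cyc = trans (mult≡posMult+negMult G _ _) (cong₂ _+_ (proj₁ (mult≡ i j)) (proj₂ (mult≡ i j)))
  1≤m+m⇒1≤m : ∀ {m} → 1 ≤ m + m → 1 ≤ m
  1≤m+m⇒1≤m {suc _} _ = s≤s z≤n

cycle-mult≤ : ∀ G (cycle : IsCycle G) {c} → (∀ i j → cycMult (n G) i j ≤ c) → ∀ a b → mult G a b ≤ c
cycle-mult≤ G (_ , π , π-injective , mult≡) {c} cyc≤c a b
  with injective⇒surjective π π-injective a | injective⇒surjective π π-injective b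
... | i , refl | j , refl = subst (_≤ c) (sym (mult≡ i j)) (cyc≤c i j)

-- Bricks

-- On one vertex every edge would be a loop, so the pair is uncolourable exactly when the list is empty.
one-vertex-lists : ∀ G L X → n G ≡ 1 → ¬ LColorable G L → SignedCopyLists G L X
one-vertex-lists G L X n≡1 uncolourable = [] , [] , sym Δ≡0 , (λ v _ → empty v) , (λ v _ → empty v)
  where
  same : ∀ a b → a ≡ b
  same = Fin-one-point n≡1
  empty : ∀ v → SameSet (L v) []
  empty v c = mk⇔ (λ c∈Lv → contradiction ((λ _ → c) , no-edges , λ v′ → subst (λ x → c ∈ L x) (same v v′) c∈Lv) uncolourable) λ ()
    where
    no-edges : IsColoring G (λ _ → c)
    no-edges = All.tabulate λ { {a , b , _} e∈G → contradiction (same a b) (All.lookup (noLoop G) e∈G) }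
  Δ≡0 : Δ G ≡ 0
  Δ≡0 = n≤0⇒n≡0 (≤-trans (Δ-lub G (deg≤pred[n]* G {0} λ a b a≢b → contradiction (same a b) a≢b)) (≤-reflexive (*-zeroʳ (pred (n G)))))

balanced-complete-uncolourable⇔ : ∀ G L X → BalancedWith G X → 1 ≤ n G → IsComplete G →
  UncolorablePair G L ⇔ SignedCopyLists G L X
balanced-complete-uncolourable⇔ G L X balanced 1≤n complete = mk⇔ necessary sufficient
  where
  adjacency : CompleteAdjacency G
  adjacency a b a≢b = mult≥1⇒adjacent G (≤-reflexive (sym (complete a b a≢b)))
  necessary : UncolorablePair G L → SignedCopyLists G L X
  necessary pair with 2 ≤? n G
  ... | yes 2≤n = ForcedLists.signed-copies G L pair 2≤n (complete-orderings G adjacency) X balanced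
  ... | no 2≰n = one-vertex-lists G L X (≤-antisym (≮⇒≥ 2≰n) 1≤n) (proj₂ (proj₂ pair))
  sufficient : SignedCopyLists G L X → UncolorablePair G L
  sufficient (C , unique-C , |C|≡Δ , on-X , on-Y) = complete-connected G adjacency , large ,
    complete-uncolourable adjacency (m≤pred[n]⇒suc[m]≤n {{>-nonZero 1≤n}} Δ≤pred[n])
    where
    open TwistedColouring G L X balanced unique-C |C|≡Δ on-X on-Y
    Δ≤pred[n] : Δ G ≤ pred (n G)
    Δ≤pred[n] = ≤-trans (Δ-lub G (deg≤pred[n]* G (λ a b a≢b → ≤-reflexive (complete a b a≢b)))) (≤-reflexive (*-identityʳ _))

balanced-odd-cycle-uncolourable⇔ : ∀ G L X → BalancedWith G X → IsCycle G → Odd (n G) →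
  UncolorablePair G L ⇔ SignedCopyLists G L X
balanced-odd-cycle-uncolourable⇔ G L X balanced cycle@(2≤n , π , π-injective , _) odd =
  mk⇔ (λ pair → ForcedLists.signed-copies G L pair 2≤n orderings X balanced) sufficient
  where
  open CycleWalk G 2≤n π π-injective (cycle-adjacent⇔ G cycle)
  sufficient : SignedCopyLists G L X → UncolorablePair G L
  sufficient (C , unique-C , |C|≡Δ , on-X , on-Y) = connected , large ,
    odd-cycle-uncolourable walk walk-adjacent (walk-+N 0) odd (Δ-lub G (deg≤2* (cycle-mult≤ G cycle (cycMult≤1 (odd⇒≥3 odd 2≤n)))))
    where open TwistedColouring G L X balanced unique-C |C|≡Δ on-X on-Y

unbalanced-even-cycle-uncolourable⇔ : ∀ G L → IsCycle G → Even (n G) → ¬ Balanced G →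
  UncolorablePair G L ⇔ SymmetricLists G L
unbalanced-even-cycle-uncolourable⇔ G L cycle@(2≤n , π , π-injective , _) even unbalanced =
  mk⇔ (λ pair → ForcedLists.symmetric-if-unbalanced G L pair 2≤n orderings unbalanced) sufficient
  where
  open CycleWalk G 2≤n π π-injective (cycle-adjacent⇔ G cycle)
  Δ≤2 : Δ G ≤ 2
  Δ≤2 with n G ℕ.≟ 2
  ... | yes n≡2 = Δ-lub G (deg≤-if-N≡2 n≡2 (cycle-mult≤ G cycle cycMult≤2))
  ... | no n≢2 = Δ-lub G (deg≤2* (cycle-mult≤ G cycle (cycMult≤1 (≤∧≢⇒< 2≤n (n≢2 ∘ sym)))))
  sufficient : SymmetricLists G L → UncolorablePair G L
  sufficient (C , unique-C , |C|≡Δ , symmetric , lists) = connected , large ,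
    bipartite-uncolourable (≤-trans (≤-reflexive |C|≡Δ) Δ≤2) (side even) (side-alternates even) (walk 0) unbalanced
    where open SymmetricListColouring G L unique-C |C|≡Δ symmetric lists

doubled-complete-uncolourable⇔ : ∀ G L → 2 ≤ n G → Is2K G → UncolorablePair G L ⇔ SymmetricLists G L
doubled-complete-uncolourable⇔ G L 2≤n doubled = mk⇔
  (λ pair → ForcedLists.symmetric-if-both-signs G L pair 2≤n (complete-orderings G adjacency) signs) sufficient
  where
  mult≡2 : ∀ a b → a ≢ b → mult G a b ≡ 2
  mult≡2 a b a≢b = trans (mult≡posMult+negMult G a b) (cong₂ _+_ (proj₁ (doubled a b a≢b)) (proj₂ (doubled a b a≢b)))
  adjacency : CompleteAdjacency G
  adjacency a b a≢b = mult≥1⇒adjacent G (≤-trans (s≤s z≤n) (≤-reflexive (sym (mult≡2 a b a≢b))))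
  signs : BothSigns G
  signs = both-signs G λ {a} {b} adj → let pos , neg = doubled a b (adjacent⇒≢ G adj) in
    ≤-reflexive (sym pos) , ≤-reflexive (sym neg)
  sufficient : SymmetricLists G L → UncolorablePair G L
  sufficient (C , unique-C , |C|≡Δ , symmetric , lists) = complete-connected G adjacency , large ,
    doubled-complete-uncolourable 2≤n adjacency signs (Δ-lub G (deg≤pred[n]* G λ a b a≢b → ≤-reflexive (mult≡2 a b a≢b)))
    where open SymmetricListColouring G L unique-C |C|≡Δ symmetric lists

doubled-odd-cycle-uncolourable⇔ : ∀ G L → Is2C G → Odd (n G) → UncolorablePair G L ⇔ SymmetricLists G L
doubled-odd-cycle-uncolourable⇔ G L cycle@(3≤n , π , π-injective , mult≡) odd =
  mk⇔ (λ pair → ForcedLists.symmetric-if-both-signs G L pair 2≤n orderings signs) sufficient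
  where
  2≤n : 2 ≤ n G
  2≤n = ≤-trans (n≤1+n 2) 3≤n
  open CycleWalk G 2≤n π π-injective (doubled-cycle-adjacent⇔ G cycle)
  signs : BothSigns G
  signs = both-signs G λ {a} {b} adj → doubled-edge (π-surjective a) (π-surjective b) adj
    where
    doubled-edge : ∀ {a b} → ∃[ i ] (π i ≡ a) → ∃[ j ] (π j ≡ b) → Adjacent G a b → 1 ≤ posMult G a b × 1 ≤ negMult G a b
    doubled-edge (i , refl) (j , refl) adj = let cyc≥1 = Equivalence.to (doubled-cycle-adjacent⇔ G cycle i j) adj in
      subst (1 ≤_) (sym (proj₁ (mult≡ i j))) cyc≥1 , subst (1 ≤_) (sym (proj₂ (mult≡ i j))) cyc≥1
  mult≤2 : ∀ a b → mult G a b ≤ 2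
  mult≤2 a b with π-surjective a | π-surjective b
  ... | i , refl | j , refl = subst (_≤ 2) (sym (trans (mult≡posMult+negMult G _ _) (cong₂ _+_ (proj₁ (mult≡ i j)) (proj₂ (mult≡ i j)))))
    (+-mono-≤ (cycMult≤1 3≤n i j) (cycMult≤1 3≤n i j))
  sufficient : SymmetricLists G L → UncolorablePair G L
  sufficient (C , unique-C , |C|≡Δ , symmetric , lists) = connected , large ,
    doubled-odd-cycle-uncolourable walk walk-adjacent (walk-+N 0) odd signs (Δ-lub G (deg≤2* mult≤2))
    where open SymmetricListColouring G L unique-C |C|≡Δ symmetric lists

lemma9 : (B : SGraph) (L : ListAssignment B) →
    ((X : _) → BalancedWith B X →
      ((1 ≤ n B × IsComplete B) ⊎ (IsCycle B × Odd (n B))) →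
      (UncolorablePair B L ⇔
        (∃[ C ] (Unique C × length C ≡ Δ B ×
          (∀ v → X v ≡ true → SameSet (L v) C) ×
          (∀ v → X v ≡ false → SameSet (L v) (neg C))))))
    ×
    (((IsCycle B × Even (n B) × ¬ Balanced B) ⊎ (2 ≤ n B × Is2K B) ⊎ (Is2C B × Odd (n B))) →
      (UncolorablePair B L ⇔
        (∃[ C ] (Unique C × length C ≡ Δ B × SameSet C (neg C) ×
          (∀ v → SameSet (L v) C)))))
lemma9 B L = balanced-brick , other-brick
  where
  balanced-brick : ∀ X → BalancedWith B X → (1 ≤ n B × IsComplete B) ⊎ (IsCycle B × Odd (n B)) →
    UncolorablePair B L ⇔ SignedCopyLists B L X
  balanced-brick X balanced (inj₁ (1≤n , complete)) = balanced-complete-uncolourable⇔ B L X balanced 1≤n complete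
  balanced-brick X balanced (inj₂ (cycle , odd)) = balanced-odd-cycle-uncolourable⇔ B L X balanced cycle odd
  other-brick : (IsCycle B × Even (n B) × ¬ Balanced B) ⊎ (2 ≤ n B × Is2K B) ⊎ (Is2C B × Odd (n B)) →
    UncolorablePair B L ⇔ SymmetricLists B L
  other-brick (inj₁ (cycle , even , unbalanced)) = unbalanced-even-cycle-uncolourable⇔ B L cycle even unbalanced
  other-brick (inj₂ (inj₁ (2≤n , doubled))) = doubled-complete-uncolourable⇔ B L 2≤n doubled
  other-brick (inj₂ (inj₂ (cycle , odd))) = doubled-odd-cycle-uncolourable⇔ B L cycle odd
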